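{- Let $\mathbf B$ and $\mathbf C$ be integral residuated lattices with $B\cap C=F$, where $F$ is a congruence filter of $\mathbf C$ strictly above all other elements of $C$, and $F$ is also a congruence filter of $\mathbf B$ compatible with $\mathbf B$; assume moreover that if some $x,y\in B\setminus F$ satisfy $x\vee y\in F$ in $\mathbf B$, then $\mathbf C$ has a least element $0_C$. Define $\mathbf B\oplus_F\mathbf C$ on $B\cup C$ by: operations on pairs from $B$ or pairs from $C$ as in $\mathbf B$, resp. $\mathbf C$ (except that for $x,y\in B\setminus F$ with $x\vee y\in F$ we set $x\vee y=0_C$); and for $x\in B\setminus F$, $c\in C\setminus F$: $xc=cx=\sigma_F(x)$, $c\backslash x=x/c=\gamma_F(x)$, $x\backslash c=c/x=1$, $x\wedge c=c\wedge x=x$, $x\vee c=c\vee x=c$. Then $\mathbf B\oplus_F\mathbf C$ is an integral residuated lattice and it is the gluing of $\mathbf B$ and $\mathbf C$ over $F$.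
   Context: An IRL is a residuated lattice ($xy\le z\iff y\le x\backslash z\iff x\le z/y$) whose monoid unit $1$ is the top. A congruence filter of an IRL is a nonempty upset closed under products and conjugates ($x\in F\Rightarrow yx/y,\ y\backslash xy\in F$); $[x]_F$ is the class of $x$ under $\theta_F=\{(x,y): x\backslash y,y\backslash x\in F\}$. $F$ is compatible with $\mathbf B$ if: every element of $F$ is strictly above every element of $B\setminus F$; for each $b\in B\setminus F$, $[b]_F$ has a minimum $\sigma_F(b)$ and a maximum $\gamma_F(b)$; and for all $b\in B\setminus F$, $b\,\sigma_F[B\setminus F]\subseteq\sigma_F[B\setminus F]$ and $\sigma_F[B\setminus F]\,b\subseteq\sigma_F[B\setminus F]$. Given IRLs $\mathbf B,\mathbf C$, a gluing of $\mathbf B$ and $\mathbf C$ over $F$ is an IRL $\mathbf D$ with universe $B\cup C$ such that $F=B\cap C$ is a congruence filter of $\mathbf D$, $b<c<f$ for all $b\in B\setminus F$, $c\in C\setminus F$, $f\in F$, $C$ is a subalgebra of $\mathbf D$, and $B$ is a subalgebra except possibly with respect to $\vee$ (in which case $F$ has a bottom element). -}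

module Defs where

open import Level using (0ℓ)
open import Data.Product using (Σ; _×_; _,_; proj₁)
open import Data.Sum using (_⊎_)
open import Relation.Nullary using (¬_; Dec; yes; no)
open import Relation.Binary.PropositionalEquality using (_≡_; _≢_)
open import Axiom.ExcludedMiddle using (ExcludedMiddle)

-- An algebra is represented by a subset S of an ambient type U (its universe)
-- together with operations on U; only their values on S matter.
-- All algebras considered live in the same ambient type U, so that
-- intersections and unions of universes (B ∩ C, B ∪ C) make sense.
record Ops (U : Set) : Set where
  field
    meet : U → U → U
    join : U → U → U
    mul  : U → U → U
    ldiv : U → U → U
    rdiv : U → U → U
    one  : U

module Order {U : Set} (O : Ops U) where
  open Ops O
  _≤_ : U → U → Set
  x ≤ y = meet x y ≡ x
  _<_ : U → U → Set
  x < y = (x ≤ y) × (x ≢ y)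

record IsIRL {U : Set} (S : U → Set) (O : Ops U) : Set where
  open Ops O
  open Order O
  field
    meet-closed : ∀ {x y} → S x → S y → S (meet x y)
    join-closed : ∀ {x y} → S x → S y → S (join x y)
    mul-closed  : ∀ {x y} → S x → S y → S (mul x y)
    ldiv-closed : ∀ {x y} → S x → S y → S (ldiv x y)
    rdiv-closed : ∀ {x y} → S x → S y → S (rdiv x y)
    one-closed  : S one
    meet-comm   : ∀ {x y} → S x → S y → meet x y ≡ meet y x
    join-comm   : ∀ {x y} → S x → S y → join x y ≡ join y x
    meet-assoc  : ∀ {x y z} → S x → S y → S z → meet (meet x y) z ≡ meet x (meet y z)
    join-assoc  : ∀ {x y z} → S x → S y → S z → join (join x y) z ≡ join x (join y z)
    meet-absorb : ∀ {x y} → S x → S y → meet x (join x y) ≡ x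
    join-absorb : ∀ {x y} → S x → S y → join x (meet x y) ≡ x
    mul-assoc   : ∀ {x y z} → S x → S y → S z → mul (mul x y) z ≡ mul x (mul y z)
    one-left    : ∀ {x} → S x → mul one x ≡ x
    one-right   : ∀ {x} → S x → mul x one ≡ x
    res-ldiv-to   : ∀ {x y z} → S x → S y → S z → mul x y ≤ z → y ≤ ldiv x z
    res-ldiv-from : ∀ {x y z} → S x → S y → S z → y ≤ ldiv x z → mul x y ≤ z
    res-rdiv-to   : ∀ {x y z} → S x → S y → S z → mul x y ≤ z → x ≤ rdiv z y
    res-rdiv-from : ∀ {x y z} → S x → S y → S z → x ≤ rdiv z y → mul x y ≤ z
    integral    : ∀ {x} → S x → x ≤ one

record IsCongFilter {U : Set} (S : U → Set) (O : Ops U) (F : U → Set) : Set where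
  open Ops O
  open Order O
  field
    subset    : ∀ {x} → F x → S x
    nonempty  : Σ U F
    upset     : ∀ {x y} → F x → S y → x ≤ y → F y
    mul-closed : ∀ {x y} → F x → F y → F (mul x y)
    conj-right : ∀ {x y} → F x → S y → F (rdiv (mul y x) y)
    conj-left  : ∀ {x y} → F x → S y → F (ldiv y (mul x y))

module Classes {U : Set} (S : U → Set) (O : Ops U) (F : U → Set) where
  open Ops O
  open Order O

  θ : U → U → Set
  θ x y = F (ldiv x y) × F (ldiv y x)

  IsMinClass : U → U → Set
  IsMinClass b m = S m × θ b m × (∀ y → S y → θ b y → m ≤ y)

  IsMaxClass : U → U → Set
  IsMaxClass b m = S m × θ b m × (∀ y → S y → θ b y → y ≤ m)

record Compatible {U : Set} (S : U → Set) (O : Ops U) (F : U → Set) : Set where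
  open Ops O
  open Order O
  open Classes S O F
  field
    above : ∀ {f b} → F f → S b → ¬ F b → b < f
    σ-ex  : ∀ {b} → S b → ¬ F b → Σ U (IsMinClass b)
    γ-ex  : ∀ {b} → S b → ¬ F b → Σ U (IsMaxClass b)
    -- b σ_F[B∖F] ⊆ σ_F[B∖F]
    σ-left  : ∀ {b a s} → S b → ¬ F b → S a → ¬ F a → IsMinClass a s →
              Σ U (λ a' → S a' × ¬ F a' × IsMinClass a' (mul b s))
    -- σ_F[B∖F] b ⊆ σ_F[B∖F]
    σ-right : ∀ {b a s} → S b → ¬ F b → S a → ¬ F a → IsMinClass a s →
              Σ U (λ a' → S a' × ¬ F a' × IsMinClass a' (mul s b))

StrictlyAbove : {U : Set} → (U → Set) → Ops U → (U → Set) → Set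
StrictlyAbove {U} S O F = ∀ {f c} → F f → S c → ¬ F c → c < f
  where open Order O

AgreeOn : {U : Set} → (U → Set) → Ops U → Ops U → Set
AgreeOn F B C = ∀ {x y} → F x → F y →
    (Ops.meet B x y ≡ Ops.meet C x y) × (Ops.join B x y ≡ Ops.join C x y)
  × (Ops.mul B x y ≡ Ops.mul C x y) × (Ops.ldiv B x y ≡ Ops.ldiv C x y)
  × (Ops.rdiv B x y ≡ Ops.rdiv C x y)

JoinEscapes : {U : Set} → (U → Set) → Ops U → (U → Set) → Set
JoinEscapes {U} SB B F =
  Σ U λ x → Σ U λ y → SB x × ¬ F x × SB y × ¬ F y × F (Ops.join B x y)

HasLeast : {U : Set} → (U → Set) → Ops U → Set
HasLeast {U} S O = Σ U λ z → S z × (∀ c → S c → z ≤ c)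
  where open Order O

JoinHyp : {U : Set} → (U → Set) → Ops U → (U → Set) → (U → Set) → Ops U → Set
JoinHyp SB B F SC C = JoinEscapes SB B F → HasLeast SC C

module Construction {U : Set} (lem : ExcludedMiddle 0ℓ)
    (SB : U → Set) (B : Ops U) (SC : U → Set) (C : Ops U) (F : U → Set)
    (F⊆C : ∀ {u} → F u → SC u)
    (cp : Compatible SB B F) (jh : JoinHyp SB B F SC C) where

  σ : ∀ x → SB x → ¬ F x → U
  σ x bx nx = proj₁ (Compatible.σ-ex cp bx nx)

  γ : ∀ x → SB x → ¬ F x → U
  γ x bx nx = proj₁ (Compatible.γ-ex cp bx nx)

  -- generic gluing of a binary operation:
  --   BB on pairs from B, CC on pairs from C,
  --   BC x c for x ∈ B∖F, c ∈ C∖F,  CB c x for c ∈ C∖F, x ∈ B∖F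
  glue : (BB CC : U → U → U)
       → ((x : U) → SB x → ¬ F x → U → U)
       → (U → (y : U) → SB y → ¬ F y → U)
       → U → U → U
  glue BB CC BC CB x y with lem {SB x} | lem {SB y} | lem {SC x} | lem {SC y}
  ... | yes _  | yes _  | _      | _      = BB x y
  ... | _      | _      | yes _  | yes _  = CC x y
  ... | yes bx | _      | no ncx | _      = BC x bx (λ fx → ncx (F⊆C fx)) y
  ... | _      | yes by | _      | no ncy = CB x y by (λ fy → ncy (F⊆C fy))
  ... | _      | _      | _      | _      = x

  joinB : U → U → U
  joinB x y with lem {SB x × ¬ F x × SB y × ¬ F y × F (Ops.join B x y)}
  ... | yes p = proj₁ (jh (x , y , p))
  ... | no _  = Ops.join B x y

  ⊕ : Ops U
  ⊕ = record
    { meet = glue (Ops.meet B) (Ops.meet C) (λ x _ _ c → x) (λ c x _ _ → x)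
    ; join = glue joinB (Ops.join C) (λ x _ _ c → c) (λ c x _ _ → c)
    ; mul  = glue (Ops.mul B) (Ops.mul C) (λ x bx nx c → σ x bx nx) (λ c x bx nx → σ x bx nx)
    ; ldiv = glue (Ops.ldiv B) (Ops.ldiv C) (λ x _ _ c → Ops.one C) (λ c x bx nx → γ x bx nx)
    ; rdiv = glue (Ops.rdiv B) (Ops.rdiv C) (λ x bx nx c → γ x bx nx) (λ c x _ _ → Ops.one C)
    ; one  = Ops.one C
    }

record IsGluing {U : Set} (SB : U → Set) (B : Ops U) (SC : U → Set) (C : Ops U)
    (F : U → Set) (SD : U → Set) (D : Ops U) : Set where
  open Ops D
  open Order D
  field
    isIRL      : IsIRL SD D
    universe   : ∀ u → (SD u → SB u ⊎ SC u) × (SB u ⊎ SC u → SD u)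
    inter      : ∀ u → (SB u × SC u → F u) × (F u → SB u × SC u)
    filter     : IsCongFilter SD D F
    order-BC   : ∀ {b c} → SB b → ¬ F b → SC c → ¬ F c → b < c
    order-CF   : ∀ {c f} → SC c → ¬ F c → F f → c < f
    C-sub      : ∀ {x y} → SC x → SC y →
                   (meet x y ≡ Ops.meet C x y) × (join x y ≡ Ops.join C x y)
                 × (mul x y ≡ Ops.mul C x y) × (ldiv x y ≡ Ops.ldiv C x y)
                 × (rdiv x y ≡ Ops.rdiv C x y)
    C-one      : one ≡ Ops.one C
    B-sub      : ∀ {x y} → SB x → SB y →
                   (meet x y ≡ Ops.meet B x y)
                 × (mul x y ≡ Ops.mul B x y) × (ldiv x y ≡ Ops.ldiv B x y)
                 × (rdiv x y ≡ Ops.rdiv B x y)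
    B-one      : one ≡ Ops.one B
    B-join     : (∀ {x y} → SB x → SB y → join x y ≡ Ops.join B x y)
                 ⊎ (Σ U λ f → F f × (∀ g → F g → f ≤ g))

module Submission where

-- The order of B ⊕_F C stacks C ∖ F strictly between B ∖ F and F, so every comparison between
-- the two parts is decided by membership in F. A mixed product x c is σ_F(x), the least element
-- of the θ_F-class of x, and a mixed residual into x is γ_F(x), its largest element. Associativity
-- of mixed products holds because both sides turn out to be the least element of one and the same
-- θ_F-class; the compatibility of F supplies exactly the closure of σ_F[B ∖ F] under products that
-- this needs. Residuation for mixed triples reduces to two facts inside B: σ_F(x) ≤ z iff x \ z ∈ F
-- (dually z / x ∈ F), and σ_F(y) ≤ z iff y ≤ γ_F(z). The lattice laws follow from the order once
-- meets and joins are shown to be greatest lower and least upper bounds; when x ∨ y escapes into F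
-- it is replaced by the least element of C, which is the least upper bound in the new order.

open import Defs
open import Level using (0ℓ)
open import Data.Product using (Σ; _×_; _,_; proj₁; proj₂)
open import Data.Sum using (_⊎_; inj₁; inj₂)
open import Data.Empty using (⊥-elim)
open import Relation.Nullary using (¬_; yes; no)
open import Relation.Binary.PropositionalEquality
  using (_≡_; refl; sym; trans; cong; subst; module ≡-Reasoning)
open import Function.Bundles using (_⇔_; mk⇔; Equivalence)
open import Function.Construct.Composition using (_⇔-∘_)
open import Function.Construct.Symmetry using (⇔-sym)
open import Axiom.ExcludedMiddle using (ExcludedMiddle)

⇔-both : ∀ {A B : Set} → A → B → A ⇔ B
⇔-both a b = mk⇔ (λ _ → b) (λ _ → a)

⇔-neither : ∀ {A B : Set} → ¬ A → ¬ B → A ⇔ B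
⇔-neither ¬a ¬b = mk⇔ (λ a → ⊥-elim (¬a a)) (λ b → ⊥-elim (¬b b))

module IRLProperties {U : Set} {S : U → Set} {O : Ops U} (irl : IsIRL S O) where
  open Ops O renaming (meet to infixr 6 _∧_; join to infixr 5 _∨_; mul to infixl 8 _·_;
                       ldiv to infixr 7 _⧵_; rdiv to infixl 7 _/_)
  open Order O renaming (_≤_ to infix 4 _≤_)
  open IsIRL irl
  open ≡-Reasoning

  ≤-refl : ∀ {x} → S x → x ≤ x
  ≤-refl {x} sx = begin
    x ∧ x             ≡⟨ cong (x ∧_) (sym (join-absorb sx sx)) ⟩
    x ∧ (x ∨ x ∧ x)   ≡⟨ meet-absorb sx (meet-closed sx sx) ⟩
    x                 ∎

  ≤-antisym : ∀ {x y} → S x → S y → x ≤ y → y ≤ x → x ≡ y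
  ≤-antisym sx sy x≤y y≤x = trans (sym x≤y) (trans (meet-comm sx sy) y≤x)

  ≤-trans : ∀ {x y z} → S x → S y → S z → x ≤ y → y ≤ z → x ≤ z
  ≤-trans {x} {y} {z} sx sy sz x≤y y≤z = begin
    x ∧ z         ≡⟨ cong (_∧ z) (sym x≤y) ⟩
    (x ∧ y) ∧ z   ≡⟨ meet-assoc sx sy sz ⟩
    x ∧ (y ∧ z)   ≡⟨ cong (x ∧_) y≤z ⟩
    x ∧ y         ≡⟨ x≤y ⟩
    x             ∎

  meet≤ˡ : ∀ {x y} → S x → S y → x ∧ y ≤ x
  meet≤ˡ {x} {y} sx sy = begin
    (x ∧ y) ∧ x   ≡⟨ meet-comm (meet-closed sx sy) sx ⟩
    x ∧ (x ∧ y)   ≡⟨ sym (meet-assoc sx sx sy) ⟩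
    (x ∧ x) ∧ y   ≡⟨ cong (_∧ y) (≤-refl sx) ⟩
    x ∧ y         ∎

  meet≤ʳ : ∀ {x y} → S x → S y → x ∧ y ≤ y
  meet≤ʳ {x} {y} sx sy = trans (meet-assoc sx sy sy) (cong (x ∧_) (≤-refl sy))

  meet-greatest : ∀ {x y z} → S x → S y → S z → z ≤ x → z ≤ y → z ≤ x ∧ y
  meet-greatest {x} {y} {z} sx sy sz z≤x z≤y = begin
    z ∧ (x ∧ y)   ≡⟨ sym (meet-assoc sz sx sy) ⟩
    (z ∧ x) ∧ y   ≡⟨ cong (_∧ y) z≤x ⟩
    z ∧ y         ≡⟨ z≤y ⟩
    z             ∎

  ≤joinˡ : ∀ {x y} → S x → S y → x ≤ x ∨ y
  ≤joinˡ = meet-absorb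

  ≤joinʳ : ∀ {x y} → S x → S y → y ≤ x ∨ y
  ≤joinʳ {x} {y} sx sy = trans (cong (y ∧_) (join-comm sx sy)) (meet-absorb sy sx)

  ≤⇒join≡ : ∀ {x y} → S x → S y → x ≤ y → x ∨ y ≡ y
  ≤⇒join≡ {x} {y} sx sy x≤y = begin
    x ∨ y         ≡⟨ cong (_∨ y) (sym x≤y) ⟩
    x ∧ y ∨ y     ≡⟨ join-comm (meet-closed sx sy) sy ⟩
    y ∨ x ∧ y     ≡⟨ cong (y ∨_) (meet-comm sx sy) ⟩
    y ∨ y ∧ x     ≡⟨ join-absorb sy sx ⟩
    y             ∎

  join-least : ∀ {x y z} → S x → S y → S z → x ≤ z → y ≤ z → x ∨ y ≤ z
  join-least {x} {y} {z} sx sy sz x≤z y≤z =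
    trans (cong ((x ∨ y) ∧_) (sym x∨y∨z≡z)) (meet-absorb (join-closed sx sy) sz)
    where
    x∨y∨z≡z : (x ∨ y) ∨ z ≡ z
    x∨y∨z≡z = begin
      (x ∨ y) ∨ z   ≡⟨ join-assoc sx sy sz ⟩
      x ∨ (y ∨ z)   ≡⟨ cong (x ∨_) (≤⇒join≡ sy sz y≤z) ⟩
      x ∨ z         ≡⟨ ≤⇒join≡ sx sz x≤z ⟩
      z             ∎

  join-mono : ∀ {x y x′ y′} → S x → S y → S x′ → S y′ → x ≤ x′ → y ≤ y′ → x ∨ y ≤ x′ ∨ y′
  join-mono sx sy sx′ sy′ x≤x′ y≤y′ = join-least sx sy (join-closed sx′ sy′)
    (≤-trans sx sx′ (join-closed sx′ sy′) x≤x′ (≤joinˡ sx′ sy′))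
    (≤-trans sy sy′ (join-closed sx′ sy′) y≤y′ (≤joinʳ sx′ sy′))

  ldiv-cancel : ∀ {x z} → S x → S z → x · (x ⧵ z) ≤ z
  ldiv-cancel sx sz = res-ldiv-from sx (ldiv-closed sx sz) sz (≤-refl (ldiv-closed sx sz))

  rdiv-cancel : ∀ {y z} → S y → S z → (z / y) · y ≤ z
  rdiv-cancel sy sz = res-rdiv-from (rdiv-closed sz sy) sy sz (≤-refl (rdiv-closed sz sy))

  mul-monoʳ : ∀ {x y y′} → S x → S y → S y′ → y ≤ y′ → x · y ≤ x · y′
  mul-monoʳ sx sy sy′ y≤y′ = res-ldiv-from sx sy (mul-closed sx sy′)
    (≤-trans sy sy′ (ldiv-closed sx (mul-closed sx sy′)) y≤y′
      (res-ldiv-to sx sy′ (mul-closed sx sy′) (≤-refl (mul-closed sx sy′))))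

  mul-monoˡ : ∀ {x x′ y} → S x → S x′ → S y → x ≤ x′ → x · y ≤ x′ · y
  mul-monoˡ sx sx′ sy x≤x′ = res-rdiv-from sx sy (mul-closed sx′ sy)
    (≤-trans sx sx′ (rdiv-closed (mul-closed sx′ sy) sy) x≤x′
      (res-rdiv-to sx′ sy (mul-closed sx′ sy) (≤-refl (mul-closed sx′ sy))))

  mul≤ˡ : ∀ {x y} → S x → S y → x · y ≤ x
  mul≤ˡ {x} {y} sx sy =
    subst (x · y ≤_) (one-right sx) (mul-monoʳ sx sy one-closed (integral sy))

  mul≤ʳ : ∀ {x y} → S x → S y → x · y ≤ y
  mul≤ʳ {x} {y} sx sy =
    subst (x · y ≤_) (one-left sy) (mul-monoˡ sx one-closed sy (integral sx))

  ldiv-monoʳ : ∀ {x z z′} → S x → S z → S z′ → z ≤ z′ → x ⧵ z ≤ x ⧵ z′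
  ldiv-monoʳ sx sz sz′ z≤z′ = res-ldiv-to sx (ldiv-closed sx sz) sz′
    (≤-trans (mul-closed sx (ldiv-closed sx sz)) sz sz′ (ldiv-cancel sx sz) z≤z′)

  rdiv-monoˡ : ∀ {y z z′} → S y → S z → S z′ → z ≤ z′ → z / y ≤ z′ / y
  rdiv-monoˡ sy sz sz′ z≤z′ = res-rdiv-to (rdiv-closed sz sy) sy sz′
    (≤-trans (mul-closed (rdiv-closed sz sy) sy) sz sz′ (rdiv-cancel sy sz) z≤z′)

  ≤⇒one≤ldiv : ∀ {x z} → S x → S z → x ≤ z → one ≤ x ⧵ z
  ≤⇒one≤ldiv {x} {z} sx sz x≤z =
    res-ldiv-to sx one-closed sz (subst (_≤ z) (sym (one-right sx)) x≤z)

  ≤⇒one≤rdiv : ∀ {y z} → S y → S z → y ≤ z → one ≤ z / y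
  ≤⇒one≤rdiv {y} {z} sy sz y≤z =
    res-rdiv-to one-closed sy sz (subst (_≤ z) (sym (one-left sy)) y≤z)

  mul-distribʳ-join : ∀ {x z a} → S x → S z → S a → (x ∨ z) · a ≤ x · a ∨ z · a
  mul-distribʳ-join sx sz sa = res-rdiv-from (join-closed sx sz) sa xa∨za
    (join-least sx sz (rdiv-closed xa∨za sa)
      (res-rdiv-to sx sa xa∨za (≤joinˡ (mul-closed sx sa) (mul-closed sz sa)))
      (res-rdiv-to sz sa xa∨za (≤joinʳ (mul-closed sx sa) (mul-closed sz sa))))
    where xa∨za = join-closed (mul-closed sx sa) (mul-closed sz sa)

module CongruenceFilterProperties {U : Set} {S : U → Set} {O : Ops U} (irl : IsIRL S O)
    {F : U → Set} (filter : IsCongFilter S O F) where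
  open Ops O renaming (meet to infixr 6 _∧_; join to infixr 5 _∨_; mul to infixl 8 _·_;
                       ldiv to infixr 7 _⧵_; rdiv to infixl 7 _/_)
  open Order O renaming (_≤_ to infix 4 _≤_)
  open IsIRL irl
  open IRLProperties irl
  open IsCongFilter filter renaming (subset to F⊆S; mul-closed to F-mul-closed)
  open Classes S O F

  one∈F : F one
  one∈F = upset (proj₂ nonempty) one-closed (integral (F⊆S (proj₂ nonempty)))

  ldiv-mp : ∀ {x y} → F x → F (x ⧵ y) → S y → F y
  ldiv-mp fx fx⧵y sy = upset (F-mul-closed fx fx⧵y) sy (ldiv-cancel (F⊆S fx) sy)

  rdiv-mp : ∀ {x y} → F (y / x) → F x → S y → F y
  rdiv-mp fy/x fx sy = upset (F-mul-closed fy/x fx) sy (rdiv-cancel (F⊆S fx) sy)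

  ∉F-downward : ∀ {x y} → S x → S y → y ≤ x → ¬ F x → ¬ F y
  ∉F-downward sx sy y≤x x∉F fy = x∉F (upset fy sx y≤x)

  ∉F-mulˡ : ∀ {x y} → S x → S y → ¬ F x → ¬ F (x · y)
  ∉F-mulˡ sx sy = ∉F-downward sx (mul-closed sx sy) (mul≤ˡ sx sy)

  ∉F-mulʳ : ∀ {x y} → S x → S y → ¬ F y → ¬ F (x · y)
  ∉F-mulʳ sx sy = ∉F-downward sy (mul-closed sx sy) (mul≤ʳ sx sy)

  ≤⇒ldiv∈F : ∀ {x y} → S x → S y → x ≤ y → F (x ⧵ y)
  ≤⇒ldiv∈F sx sy x≤y = upset one∈F (ldiv-closed sx sy) (≤⇒one≤ldiv sx sy x≤y)

  ≤⇒rdiv∈F : ∀ {x y} → S x → S y → x ≤ y → F (y / x)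
  ≤⇒rdiv∈F sx sy x≤y = upset one∈F (rdiv-closed sy sx) (≤⇒one≤rdiv sx sy x≤y)

  θ-sym : ∀ {x y} → θ x y → θ y x
  θ-sym (p , q) = q , p

  θ-trans : ∀ {x y z} → S x → S y → S z → θ x y → θ y z → θ x z
  θ-trans sx sy sz (x⧵y , y⧵x) (y⧵z , z⧵y) = compose sx sy sz x⧵y y⧵z , compose sz sy sx z⧵y y⧵x
    where
    compose : ∀ {x y z} → S x → S y → S z → F (x ⧵ y) → F (y ⧵ z) → F (x ⧵ z)
    compose {x} {y} {z} sx sy sz p q = upset (F-mul-closed p q) (ldiv-closed sx sz)
      (res-ldiv-to sx (mul-closed sxy syz) sz
        (subst (_≤ z) (mul-assoc sx sxy syz)
          (≤-trans (mul-closed (mul-closed sx sxy) syz) (mul-closed sy syz) sz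
            (mul-monoˡ (mul-closed sx sxy) sy syz (ldiv-cancel sx sy)) (ldiv-cancel sy sz))))
      where sxy = ldiv-closed sx sy
            syz = ldiv-closed sy sz

  θ-∉F : ∀ {x y} → S x → θ x y → ¬ F x → ¬ F y
  θ-∉F sx (_ , y⧵x) x∉F fy = x∉F (ldiv-mp fy y⧵x sx)

  θ-one : ∀ {f} → F f → θ f one
  θ-one {f} ff = ≤⇒ldiv∈F sf one-closed (integral sf) ,
    upset ff (ldiv-closed one-closed sf)
      (res-ldiv-to one-closed sf sf (subst (_≤ f) (sym (one-left sf)) (≤-refl sf)))
    where sf = F⊆S ff

  θ-mulˡ : ∀ {x y z} → S x → S y → S z → θ x y → θ (z · x) (z · y)
  θ-mulˡ {z = z} sx sy sz (x⧵y , y⧵x) = compat sx sy x⧵y , compat sy sx y⧵x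
    where
    compat : ∀ {x y} → S x → S y → F (x ⧵ y) → F (z · x ⧵ z · y)
    compat {x} {y} sx sy p = upset p (ldiv-closed (mul-closed sz sx) (mul-closed sz sy))
      (res-ldiv-to (mul-closed sz sx) sa (mul-closed sz sy)
        (subst (_≤ z · y) (sym (mul-assoc sz sx sa))
          (mul-monoʳ sz (mul-closed sx sa) sy (ldiv-cancel sx sy))))
      where sa = ldiv-closed sx sy

  -- Right multiplication needs the conjugate z ⧵ (x ⧵ y) z, which lies in F by normality.
  θ-mulʳ : ∀ {x y z} → S x → S y → S z → θ x y → θ (x · z) (y · z)
  θ-mulʳ {z = z} sx sy sz (x⧵y , y⧵x) = compat sx sy x⧵y , compat sy sx y⧵x
    where
    compat : ∀ {x y} → S x → S y → F (x ⧵ y) → F (x · z ⧵ y · z)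
    compat {x} {y} sx sy p = upset (conj-left p sz) (ldiv-closed (mul-closed sx sz) (mul-closed sy sz))
      (res-ldiv-to (mul-closed sx sz) sb (mul-closed sy sz)
        (subst (_≤ y · z) (sym (mul-assoc sx sz sb))
          (≤-trans (mul-closed sx (mul-closed sz sb)) (mul-closed sx saz) (mul-closed sy sz)
            (mul-monoʳ sx (mul-closed sz sb) saz (ldiv-cancel sz saz))
            (subst (_≤ y · z) (mul-assoc sx sa sz)
              (mul-monoˡ (mul-closed sx sa) sy sz (ldiv-cancel sx sy))))))
      where sa = ldiv-closed sx sy
            saz = mul-closed sa sz
            sb = ldiv-closed sz saz

  θ-meet : ∀ {x y z} → S x → S y → S z → θ x y → θ (z ∧ x) (z ∧ y)
  θ-meet {z = z} sx sy sz (x⧵y , y⧵x) = compat sx sy x⧵y , compat sy sx y⧵x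
    where
    compat : ∀ {x y} → S x → S y → F (x ⧵ y) → F ((z ∧ x) ⧵ (z ∧ y))
    compat sx sy p = upset p (ldiv-closed szx szy)
      (res-ldiv-to szx sa szy
        (meet-greatest sz sy (mul-closed szx sa)
          (≤-trans (mul-closed szx sa) szx sz (mul≤ˡ szx sa) (meet≤ˡ sz sx))
          (≤-trans (mul-closed szx sa) (mul-closed sx sa) sy
            (mul-monoˡ szx sx sa (meet≤ʳ sz sx)) (ldiv-cancel sx sy))))
      where sa = ldiv-closed sx sy
            szx = meet-closed sz sx
            szy = meet-closed sz sy

  θ-join : ∀ {x y z} → S x → S y → S z → θ x y → θ (x ∨ z) (y ∨ z)
  θ-join {z = z} sx sy sz (x⧵y , y⧵x) = compat sx sy x⧵y , compat sy sx y⧵x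
    where
    compat : ∀ {x y} → S x → S y → F (x ⧵ y) → F ((x ∨ z) ⧵ (y ∨ z))
    compat sx sy p = upset p (ldiv-closed sxz syz)
      (res-ldiv-to sxz sa syz
        (≤-trans (mul-closed sxz sa) (join-closed (mul-closed sx sa) (mul-closed sz sa)) syz
          (mul-distribʳ-join sx sz sa)
          (join-mono (mul-closed sx sa) (mul-closed sz sa) sy sz
            (ldiv-cancel sx sy) (mul≤ˡ sz sa))))
      where sa = ldiv-closed sx sy
            sxz = join-closed sx sz
            syz = join-closed sy sz

  F-mulˡ-θ : ∀ {f w} → F f → S w → θ (f · w) w
  F-mulˡ-θ {f} {w} ff sw = subst (θ (f · w)) (one-left sw)
    (θ-mulʳ (F⊆S ff) one-closed sw (θ-one ff))

  F-mulʳ-θ : ∀ {f w} → F f → S w → θ (w · f) w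
  F-mulʳ-θ {f} {w} ff sw = subst (θ (w · f)) (one-right sw)
    (θ-mulˡ (F⊆S ff) one-closed sw (θ-one ff))

  min-∉F : ∀ {a m} → S a → IsMinClass a m → ¬ F a → ¬ F m
  min-∉F sa (_ , am , _) = θ-∉F sa am

  max-∉F : ∀ {a g} → S a → IsMaxClass a g → ¬ F a → ¬ F g
  max-∉F sa (_ , ag , _) = θ-∉F sa ag

  min-unique : ∀ {a m m′} → IsMinClass a m → IsMinClass a m′ → m ≡ m′
  min-unique (sm , am , m-least) (sm′ , am′ , m′-least) =
    ≤-antisym sm sm′ (m-least _ sm′ am′) (m′-least _ sm am)

  min-transfer : ∀ {a a′ m} → S a → S a′ → θ a a′ → IsMinClass a m → IsMinClass a′ m
  min-transfer sa sa′ aa′ (sm , am , m-least) =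
    sm , θ-trans sa′ sa sm (θ-sym aa′) am , λ y sy a′y → m-least y sy (θ-trans sa sa′ sy aa′ a′y)

  min-idem : ∀ {a m} → S a → IsMinClass a m → IsMinClass m m
  min-idem sa min@(sm , am , _) = min-transfer sa sm am min

  ≤min⇒≡min : ∀ {a m w} → S w → IsMinClass a m → θ a w → w ≤ m → w ≡ m
  ≤min⇒≡min sw (sm , _ , m-least) aw w≤m = ≤-antisym sw sm w≤m (m-least _ sw aw)

  min-absorbʳ : ∀ {a m f} → S a → IsMinClass a m → F f → m · f ≡ m
  min-absorbʳ sa min@(sm , am , _) ff = ≤min⇒≡min smf min
    (θ-trans sa sm smf am (θ-sym (F-mulʳ-θ ff sm))) (mul≤ˡ sm (F⊆S ff))
    where smf = mul-closed sm (F⊆S ff)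

  min-absorbˡ : ∀ {a m f} → S a → IsMinClass a m → F f → f · m ≡ m
  min-absorbˡ sa min@(sm , am , _) ff = ≤min⇒≡min sfm min
    (θ-trans sa sm sfm am (θ-sym (F-mulˡ-θ ff sm))) (mul≤ʳ (F⊆S ff) sm)
    where sfm = mul-closed (F⊆S ff) sm

  min≤⇒ldiv∈F : ∀ {x s z} → S x → IsMinClass x s → S z → s ≤ z → F (x ⧵ z)
  min≤⇒ldiv∈F sx (ss , (x⧵s , _) , _) sz s≤z =
    upset x⧵s (ldiv-closed sx sz) (ldiv-monoʳ sx ss sz s≤z)

  ldiv∈F⇒min≤ : ∀ {x s z} → S x → IsMinClass x s → S z → F (x ⧵ z) → s ≤ z
  ldiv∈F⇒min≤ {x} {s} {z} sx (ss , _ , s-least) sz x⧵z =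
    ≤-trans ss sw sz (s-least _ sw (θ-sym w-θ-x)) (ldiv-cancel sx sz)
    where sw = mul-closed sx (ldiv-closed sx sz)
          w-θ-x : θ (x · (x ⧵ z)) x
          w-θ-x = F-mulʳ-θ x⧵z sx

  min≤⇒rdiv∈F : ∀ {y s z} → S y → IsMinClass y s → S z → s ≤ z → F (z / y)
  min≤⇒rdiv∈F sy (ss , (y⧵s , _) , _) sz s≤z = upset (conj-right y⧵s sy) (rdiv-closed sz sy)
    (rdiv-monoˡ sy (mul-closed sy (ldiv-closed sy ss)) sz
      (≤-trans (mul-closed sy (ldiv-closed sy ss)) ss sz (ldiv-cancel sy ss) s≤z))

  rdiv∈F⇒min≤ : ∀ {y s z} → S y → IsMinClass y s → S z → F (z / y) → s ≤ z
  rdiv∈F⇒min≤ sy (ss , _ , s-least) sz z/y =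
    ≤-trans ss sw sz (s-least _ sw (θ-sym (F-mulˡ-θ z/y sy))) (rdiv-cancel sy sz)
    where sw = mul-closed (rdiv-closed sz sy) sy

  min≤⇒≤max : ∀ {y s z g} → S y → IsMinClass y s → S z → IsMaxClass z g → s ≤ z → y ≤ g
  min≤⇒≤max {y} {s} {z} sy (ss , ys , _) sz (sg , _ , g-greatest) s≤z =
    ≤-trans sy syz sg (≤joinˡ sy sz) (g-greatest _ syz z-θ-y∨z)
    where syz = join-closed sy sz
          z-θ-y∨z : θ z (y ∨ z)
          z-θ-y∨z = subst (λ v → θ v (y ∨ z)) (≤⇒join≡ ss sz s≤z) (θ-join ss sy sz (θ-sym ys))

  ≤max⇒min≤ : ∀ {y s z g} → S y → IsMinClass y s → S z → IsMaxClass z g → y ≤ g → s ≤ z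
  ≤max⇒min≤ {y} {s} {z} sy (ss , _ , s-least) sz (sg , zg , _) y≤g =
    ≤-trans ss syz sz (s-least _ syz y-θ-y∧z) (meet≤ʳ sy sz)
    where syz = meet-closed sy sz
          y-θ-y∧z : θ y (y ∧ z)
          y-θ-y∧z = subst (λ v → θ v (y ∧ z)) y≤g (θ-meet sg sz sy (θ-sym zg))

record IsLatticeOrder {U : Set} (S : U → Set) (O : Ops U) : Set where
  open Ops O renaming (meet to infixr 6 _∧_; join to infixr 5 _∨_)
  open Order O renaming (_≤_ to infix 4 _≤_)
  field
    meet-closed   : ∀ {x y} → S x → S y → S (x ∧ y)
    join-closed   : ∀ {x y} → S x → S y → S (x ∨ y)
    ≤-refl        : ∀ {x} → S x → x ≤ x
    ≤-antisym     : ∀ {x y} → S x → S y → x ≤ y → y ≤ x → x ≡ y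
    ≤-trans       : ∀ {x y z} → S x → S y → S z → x ≤ y → y ≤ z → x ≤ z
    meet≤ˡ        : ∀ {x y} → S x → S y → x ∧ y ≤ x
    meet≤ʳ        : ∀ {x y} → S x → S y → x ∧ y ≤ y
    meet-greatest : ∀ {x y z} → S x → S y → S z → z ≤ x → z ≤ y → z ≤ x ∧ y
    ≤joinˡ        : ∀ {x y} → S x → S y → x ≤ x ∨ y
    ≤joinʳ        : ∀ {x y} → S x → S y → y ≤ x ∨ y
    join-least    : ∀ {x y z} → S x → S y → S z → x ≤ z → y ≤ z → x ∨ y ≤ z

  meet-comm : ∀ {x y} → S x → S y → x ∧ y ≡ y ∧ x
  meet-comm sx sy = ≤-antisym (meet-closed sx sy) (meet-closed sy sx)
    (meet-greatest sy sx (meet-closed sx sy) (meet≤ʳ sx sy) (meet≤ˡ sx sy))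
    (meet-greatest sx sy (meet-closed sy sx) (meet≤ʳ sy sx) (meet≤ˡ sy sx))

  join-comm : ∀ {x y} → S x → S y → x ∨ y ≡ y ∨ x
  join-comm sx sy = ≤-antisym (join-closed sx sy) (join-closed sy sx)
    (join-least sx sy (join-closed sy sx) (≤joinʳ sy sx) (≤joinˡ sy sx))
    (join-least sy sx (join-closed sx sy) (≤joinʳ sx sy) (≤joinˡ sx sy))

  meet-assoc : ∀ {x y z} → S x → S y → S z → (x ∧ y) ∧ z ≡ x ∧ (y ∧ z)
  meet-assoc sx sy sz = ≤-antisym sl sr
    (meet-greatest sx syz sl (≤-trans sl sxy sx (meet≤ˡ sxy sz) (meet≤ˡ sx sy))
      (meet-greatest sy sz sl (≤-trans sl sxy sy (meet≤ˡ sxy sz) (meet≤ʳ sx sy)) (meet≤ʳ sxy sz)))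
    (meet-greatest sxy sz sr
      (meet-greatest sx sy sr (meet≤ˡ sx syz) (≤-trans sr syz sy (meet≤ʳ sx syz) (meet≤ˡ sy sz)))
      (≤-trans sr syz sz (meet≤ʳ sx syz) (meet≤ʳ sy sz)))
    where sxy = meet-closed sx sy
          syz = meet-closed sy sz
          sl = meet-closed sxy sz
          sr = meet-closed sx syz

  join-assoc : ∀ {x y z} → S x → S y → S z → (x ∨ y) ∨ z ≡ x ∨ (y ∨ z)
  join-assoc sx sy sz = ≤-antisym sl sr
    (join-least sxy sz sr
      (join-least sx sy sr (≤joinˡ sx syz) (≤-trans sy syz sr (≤joinˡ sy sz) (≤joinʳ sx syz)))
      (≤-trans sz syz sr (≤joinʳ sy sz) (≤joinʳ sx syz)))
    (join-least sx syz sl (≤-trans sx sxy sl (≤joinˡ sx sy) (≤joinˡ sxy sz))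
      (join-least sy sz sl (≤-trans sy sxy sl (≤joinʳ sx sy) (≤joinˡ sxy sz)) (≤joinʳ sxy sz)))
    where sxy = join-closed sx sy
          syz = join-closed sy sz
          sl = join-closed sxy sz
          sr = join-closed sx syz

  meet-absorb : ∀ {x y} → S x → S y → x ∧ (x ∨ y) ≡ x
  meet-absorb sx sy = ≤-antisym (meet-closed sx (join-closed sx sy)) sx
    (meet≤ˡ sx (join-closed sx sy)) (meet-greatest sx (join-closed sx sy) sx (≤-refl sx) (≤joinˡ sx sy))

  join-absorb : ∀ {x y} → S x → S y → x ∨ (x ∧ y) ≡ x
  join-absorb sx sy = ≤-antisym (join-closed sx (meet-closed sx sy)) sx
    (join-least sx (meet-closed sx sy) sx (≤-refl sx) (meet≤ˡ sx sy)) (≤joinˡ sx (meet-closed sx sy))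

module Restriction {U : Set} {S′ : U → Set} {O′ : Ops U} (irl′ : IsIRL S′ O′) (O : Ops U)
    (agree : ∀ {x y} → S′ x → S′ y →
               (Ops.meet O x y ≡ Ops.meet O′ x y) × (Ops.mul O x y ≡ Ops.mul O′ x y)
             × (Ops.ldiv O x y ≡ Ops.ldiv O′ x y) × (Ops.rdiv O x y ≡ Ops.rdiv O′ x y)) where
  open Ops O renaming (mul to infixl 8 _·_; ldiv to infixr 7 _⧵_; rdiv to infixl 7 _/_)
  open Order O renaming (_≤_ to infix 4 _≤_)
  open Ops O′ using () renaming (mul to infixl 8 _·′_; ldiv to infixr 7 _⧵′_; rdiv to infixl 7 _/′_)
  open Order O′ using () renaming (_≤_ to infix 4 _≤′_)
  open IsIRL irl′

  ≤⇒≤′ : ∀ {x y} → S′ x → S′ y → x ≤ y → x ≤′ y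
  ≤⇒≤′ sx sy x≤y = trans (sym (proj₁ (agree sx sy))) x≤y

  ≤′⇒≤ : ∀ {x y} → S′ x → S′ y → x ≤′ y → x ≤ y
  ≤′⇒≤ sx sy x≤′y = trans (proj₁ (agree sx sy)) x≤′y

  private
    mul≡ : ∀ {x y} → S′ x → S′ y → x · y ≡ x ·′ y
    mul≡ sx sy = proj₁ (proj₂ (agree sx sy))

    ldiv≡ : ∀ {x y} → S′ x → S′ y → x ⧵ y ≡ x ⧵′ y
    ldiv≡ sx sy = proj₁ (proj₂ (proj₂ (agree sx sy)))

    rdiv≡ : ∀ {x y} → S′ x → S′ y → x / y ≡ x /′ y
    rdiv≡ sx sy = proj₂ (proj₂ (proj₂ (agree sx sy)))

  mul-assoc′ : ∀ {x y z} → S′ x → S′ y → S′ z → (x · y) · z ≡ x · (y · z)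
  mul-assoc′ {x} {y} {z} sx sy sz = begin
    (x · y) · z     ≡⟨ cong (_· z) (mul≡ sx sy) ⟩
    (x ·′ y) · z    ≡⟨ mul≡ (mul-closed sx sy) sz ⟩
    (x ·′ y) ·′ z   ≡⟨ mul-assoc sx sy sz ⟩
    x ·′ (y ·′ z)   ≡⟨ sym (mul≡ sx (mul-closed sy sz)) ⟩
    x · (y ·′ z)    ≡⟨ cong (x ·_) (sym (mul≡ sy sz)) ⟩
    x · (y · z)     ∎
    where open ≡-Reasoning

  residuationˡ : ∀ {x y z} → S′ x → S′ y → S′ z → (x · y ≤ z) ⇔ (y ≤ x ⧵ z)
  residuationˡ {x} {y} {z} sx sy sz = mk⇔
    (λ xy≤z → subst (y ≤_) (sym (ldiv≡ sx sz)) (≤′⇒≤ sy sx⧵z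
      (res-ldiv-to sx sy sz (≤⇒≤′ sxy sz (subst (_≤ z) (mul≡ sx sy) xy≤z)))))
    (λ y≤x⧵z → subst (_≤ z) (sym (mul≡ sx sy)) (≤′⇒≤ sxy sz
      (res-ldiv-from sx sy sz (≤⇒≤′ sy sx⧵z (subst (y ≤_) (ldiv≡ sx sz) y≤x⧵z)))))
    where sxy = mul-closed sx sy
          sx⧵z = ldiv-closed sx sz

  residuationʳ : ∀ {x y z} → S′ x → S′ y → S′ z → (x · y ≤ z) ⇔ (x ≤ z / y)
  residuationʳ {x} {y} {z} sx sy sz = mk⇔
    (λ xy≤z → subst (x ≤_) (sym (rdiv≡ sz sy)) (≤′⇒≤ sx sz/y
      (res-rdiv-to sx sy sz (≤⇒≤′ sxy sz (subst (_≤ z) (mul≡ sx sy) xy≤z)))))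
    (λ x≤z/y → subst (_≤ z) (sym (mul≡ sx sy)) (≤′⇒≤ sxy sz
      (res-rdiv-from sx sy sz (≤⇒≤′ sx sz/y (subst (x ≤_) (rdiv≡ sz sy) x≤z/y)))))
    where sxy = mul-closed sx sy
          sz/y = rdiv-closed sz sy

module GluingConstruction (lem : ExcludedMiddle 0ℓ) {U : Set}
    (SB : U → Set) (B : Ops U) (SC : U → Set) (C : Ops U) (F : U → Set)
    (irlB : IsIRL SB B) (irlC : IsIRL SC C)
    (inter : ∀ u → (SB u × SC u → F u) × (F u → SB u × SC u))
    (agree : AgreeOn F B C)
    (filterC : IsCongFilter SC C F) (aboveC : StrictlyAbove SC C F)
    (filterB : IsCongFilter SB B F) (cp : Compatible SB B F)
    (jh : JoinHyp SB B F SC C) where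

  F⊆B : ∀ {u} → F u → SB u
  F⊆B {u} fu = proj₁ (proj₂ (inter u) fu)

  F⊆C : ∀ {u} → F u → SC u
  F⊆C {u} fu = proj₂ (proj₂ (inter u) fu)

  B∩C⊆F : ∀ {u} → SB u → SC u → F u
  B∩C⊆F {u} bu cu = proj₁ (inter u) (bu , cu)

  open Construction lem SB B SC C F F⊆C cp jh

  D : Ops U
  D = ⊕

  SD : U → Set
  SD u = SB u ⊎ SC u

  open Ops D renaming (meet to infixr 6 _∧_; join to infixr 5 _∨_; mul to infixl 8 _·_;
                       ldiv to infixr 7 _⧵_; rdiv to infixl 7 _/_)
  open Order D renaming (_≤_ to infix 4 _≤_)
  open Ops B using () renaming (meet to infixr 6 _∧ᴮ_; join to infixr 5 _∨ᴮ_; mul to infixl 8 _·ᴮ_;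
                                ldiv to infixr 7 _⧵ᴮ_; rdiv to infixl 7 _/ᴮ_; one to oneᴮ)
  open Ops C using () renaming (meet to infixr 6 _∧ᶜ_; join to infixr 5 _∨ᶜ_; mul to infixl 8 _·ᶜ_;
                                ldiv to infixr 7 _⧵ᶜ_; rdiv to infixl 7 _/ᶜ_)
  open Order B using () renaming (_≤_ to infix 4 _≤ᴮ_)
  open Order C using () renaming (_≤_ to infix 4 _≤ᶜ_)
  open Classes SB B F using (IsMinClass; IsMaxClass)
  module IB = IsIRL irlB
  module IC = IsIRL irlC
  module PB = IRLProperties irlB
  module PC = IRLProperties irlC
  module FB = CongruenceFilterProperties irlB filterB
  module FC = CongruenceFilterProperties irlC filterC
  module Cp = Compatible cp

  module Glue (BB CC : U → U → U)
      (BC : (x : U) → SB x → ¬ F x → U → U)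
      (CB : U → (y : U) → SB y → ¬ F y → U) where

    glue-B : ∀ {x y} → SB x → SB y → glue BB CC BC CB x y ≡ BB x y
    glue-B {x} {y} bx by with lem {SB x} | lem {SB y} | lem {SC x} | lem {SC y}
    ... | yes _ | yes _ | _ | _ = refl
    ... | no x∉B | _ | _ | _ = ⊥-elim (x∉B bx)
    ... | yes _ | no y∉B | _ | _ = ⊥-elim (y∉B by)

    glue-C : ∀ {x y} → SC x → SC y → (F x → F y → BB x y ≡ CC x y) → glue BB CC BC CB x y ≡ CC x y
    glue-C {x} {y} cx cy BB≡CC with lem {SB x} | lem {SB y} | lem {SC x} | lem {SC y}
    ... | yes bx | yes by | _ | _ = BB≡CC (B∩C⊆F bx cx) (B∩C⊆F by cy)
    ... | no _ | _ | yes _ | yes _ = refl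
    ... | yes _ | no _ | yes _ | yes _ = refl
    ... | _ | _ | no x∉C | _ = ⊥-elim (x∉C cx)
    ... | _ | _ | yes _ | no y∉C = ⊥-elim (y∉C cy)

    -- σ and γ take membership proofs, so the mixed cases are stated at the proofs found by glue.
    glue-BC : ∀ {x y} → SB x → ¬ F x → SC y → ¬ F y →
              Σ (SB x) λ bx → Σ (¬ F x) λ nx → glue BB CC BC CB x y ≡ BC x bx nx y
    glue-BC {x} {y} bx nx cy ny with lem {SB x} | lem {SB y} | lem {SC x} | lem {SC y}
    ... | yes _ | yes by | _ | _ = ⊥-elim (ny (B∩C⊆F by cy))
    ... | no x∉B | _ | _ | _ = ⊥-elim (x∉B bx)
    ... | yes _ | no _ | yes cx | _ = ⊥-elim (nx (B∩C⊆F bx cx))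
    ... | yes bx′ | no _ | no _ | _ = bx′ , _ , refl

    glue-CB : ∀ {x y} → SC x → ¬ F x → SB y → ¬ F y →
              Σ (SB y) λ by → Σ (¬ F y) λ ny → glue BB CC BC CB x y ≡ CB x y by ny
    glue-CB {x} {y} cx nx by ny with lem {SB x} | lem {SB y} | lem {SC x} | lem {SC y}
    ... | yes bx | _ | _ | _ = ⊥-elim (nx (B∩C⊆F bx cx))
    ... | no _ | no y∉B | _ | _ = ⊥-elim (y∉B by)
    ... | no _ | yes _ | no x∉C | _ = ⊥-elim (x∉C cx)
    ... | no _ | yes _ | yes _ | yes cy = ⊥-elim (ny (B∩C⊆F by cy))
    ... | no _ | yes by′ | yes _ | no _ = by′ , _ , refl

  module Meet = Glue _∧ᴮ_ _∧ᶜ_ (λ x _ _ c → x) (λ c x _ _ → x)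
  module Join = Glue joinB _∨ᶜ_ (λ x _ _ c → c) (λ c x _ _ → c)
  module Mul  = Glue _·ᴮ_ _·ᶜ_ (λ x bx nx c → σ x bx nx) (λ c x bx nx → σ x bx nx)
  module Ldiv = Glue _⧵ᴮ_ _⧵ᶜ_ (λ x _ _ c → Ops.one C) (λ c x bx nx → γ x bx nx)
  module Rdiv = Glue _/ᴮ_ _/ᶜ_ (λ x bx nx c → γ x bx nx) (λ c x _ _ → Ops.one C)

  meet-B : ∀ {x y} → SB x → SB y → x ∧ y ≡ x ∧ᴮ y
  meet-B = Meet.glue-B

  meet-C : ∀ {x y} → SC x → SC y → x ∧ y ≡ x ∧ᶜ y
  meet-C cx cy = Meet.glue-C cx cy (λ fx fy → proj₁ (agree fx fy))

  meet-BC : ∀ {x y} → SB x → ¬ F x → SC y → ¬ F y → x ∧ y ≡ x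
  meet-BC bx nx cy ny = proj₂ (proj₂ (Meet.glue-BC bx nx cy ny))

  meet-CB : ∀ {x y} → SC x → ¬ F x → SB y → ¬ F y → x ∧ y ≡ y
  meet-CB cx nx by ny = proj₂ (proj₂ (Meet.glue-CB cx nx by ny))

  Escapes : U → U → Set
  Escapes x y = SB x × ¬ F x × SB y × ¬ F y × F (x ∨ᴮ y)

  joinB-ordinary : ∀ {x y} → ¬ Escapes x y → joinB x y ≡ x ∨ᴮ y
  joinB-ordinary {x} {y} ne with lem {Escapes x y}
  ... | yes e = ⊥-elim (ne e)
  ... | no _  = refl

  joinB-escapes : ∀ {x y} → Escapes x y → SC (joinB x y) × (∀ c → SC c → joinB x y ≤ᶜ c)
  joinB-escapes {x} {y} e with lem {Escapes x y}
  ... | yes e′ = proj₂ (jh (x , y , e′))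
  ... | no ne  = ⊥-elim (ne e)

  join-B-ordinary : ∀ {x y} → SB x → SB y → ¬ Escapes x y → x ∨ y ≡ x ∨ᴮ y
  join-B-ordinary bx by ne = trans (Join.glue-B bx by) (joinB-ordinary ne)

  join-B-escapes : ∀ {x y} → Escapes x y → SC (x ∨ y) × (∀ c → SC c → x ∨ y ≤ᶜ c)
  join-B-escapes e@(bx , _ , by , _) rewrite Join.glue-B bx by = joinB-escapes e

  join-C : ∀ {x y} → SC x → SC y → x ∨ y ≡ x ∨ᶜ y
  join-C cx cy = Join.glue-C cx cy λ fx fy →
    trans (joinB-ordinary (λ (_ , x∉F , _) → x∉F fx)) (proj₁ (proj₂ (agree fx fy)))

  join-BC : ∀ {x y} → SB x → ¬ F x → SC y → ¬ F y → x ∨ y ≡ y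
  join-BC bx nx cy ny = proj₂ (proj₂ (Join.glue-BC bx nx cy ny))

  join-CB : ∀ {x y} → SC x → ¬ F x → SB y → ¬ F y → x ∨ y ≡ x
  join-CB cx nx by ny = proj₂ (proj₂ (Join.glue-CB cx nx by ny))

  mul-B : ∀ {x y} → SB x → SB y → x · y ≡ x ·ᴮ y
  mul-B = Mul.glue-B

  mul-C : ∀ {x y} → SC x → SC y → x · y ≡ x ·ᶜ y
  mul-C cx cy = Mul.glue-C cx cy (λ fx fy → proj₁ (proj₂ (proj₂ (agree fx fy))))

  mul-BC : ∀ {x y} → SB x → ¬ F x → SC y → ¬ F y → IsMinClass x (x · y)
  mul-BC bx nx cy ny with Mul.glue-BC bx nx cy ny
  ... | bx′ , nx′ , x·y≡σx rewrite x·y≡σx = proj₂ (Cp.σ-ex bx′ nx′)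

  mul-CB : ∀ {x y} → SC x → ¬ F x → SB y → ¬ F y → IsMinClass y (x · y)
  mul-CB cx nx by ny with Mul.glue-CB cx nx by ny
  ... | by′ , ny′ , x·y≡σy rewrite x·y≡σy = proj₂ (Cp.σ-ex by′ ny′)

  ldiv-B : ∀ {x y} → SB x → SB y → x ⧵ y ≡ x ⧵ᴮ y
  ldiv-B = Ldiv.glue-B

  ldiv-C : ∀ {x y} → SC x → SC y → x ⧵ y ≡ x ⧵ᶜ y
  ldiv-C cx cy = Ldiv.glue-C cx cy (λ fx fy → proj₁ (proj₂ (proj₂ (proj₂ (agree fx fy)))))

  ldiv-BC : ∀ {x y} → SB x → ¬ F x → SC y → ¬ F y → x ⧵ y ≡ one
  ldiv-BC bx nx cy ny = proj₂ (proj₂ (Ldiv.glue-BC bx nx cy ny))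

  ldiv-CB : ∀ {x y} → SC x → ¬ F x → SB y → ¬ F y → IsMaxClass y (x ⧵ y)
  ldiv-CB cx nx by ny with Ldiv.glue-CB cx nx by ny
  ... | by′ , ny′ , x⧵y≡γy rewrite x⧵y≡γy = proj₂ (Cp.γ-ex by′ ny′)

  rdiv-B : ∀ {x y} → SB x → SB y → x / y ≡ x /ᴮ y
  rdiv-B = Rdiv.glue-B

  rdiv-C : ∀ {x y} → SC x → SC y → x / y ≡ x /ᶜ y
  rdiv-C cx cy = Rdiv.glue-C cx cy (λ fx fy → proj₂ (proj₂ (proj₂ (proj₂ (agree fx fy)))))

  rdiv-BC : ∀ {x y} → SB x → ¬ F x → SC y → ¬ F y → IsMaxClass x (x / y)
  rdiv-BC bx nx cy ny with Rdiv.glue-BC bx nx cy ny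
  ... | bx′ , nx′ , x/y≡γx rewrite x/y≡γx = proj₂ (Cp.γ-ex bx′ nx′)

  rdiv-CB : ∀ {x y} → SC x → ¬ F x → SB y → ¬ F y → x / y ≡ one
  rdiv-CB cx nx by ny = proj₂ (proj₂ (Rdiv.glue-CB cx nx by ny))

  -- Order

  data Pair (x y : U) : Set where
    both-B : SB x → SB y → Pair x y
    both-C : SC x → SC y → Pair x y
    B-C    : SB x → ¬ F x → SC y → ¬ F y → Pair x y
    C-B    : SC x → ¬ F x → SB y → ¬ F y → Pair x y

  pair : ∀ {x y} → SD x → SD y → Pair x y
  pair (inj₁ bx) (inj₁ by) = both-B bx by
  pair (inj₂ cx) (inj₂ cy) = both-C cx cy
  pair {x} {y} (inj₁ bx) (inj₂ cy) with lem {SC x} | lem {SB y}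
  ... | yes cx | _      = both-C cx cy
  ... | no _   | yes by = both-B bx by
  ... | no x∉C | no y∉B = B-C bx (λ fx → x∉C (F⊆C fx)) cy (λ fy → y∉B (F⊆B fy))
  pair {x} {y} (inj₂ cx) (inj₁ by) with lem {SB x} | lem {SC y}
  ... | yes bx | _      = both-B bx by
  ... | no _   | yes cy = both-C cx cy
  ... | no x∉B | no y∉C = C-B cx (λ fx → x∉B (F⊆B fx)) by (λ fy → y∉C (F⊆C fy))

  data Region (u : U) : Set where
    inB∖F : SB u → ¬ F u → Region u
    inF   : F u → Region u
    inC∖F : SC u → ¬ F u → Region u

  region : ∀ {u} → SD u → Region u
  region {u} su with lem {F u}
  region (inj₁ bu) | no u∉F = inB∖F bu u∉F
  region (inj₂ cu) | no u∉F = inC∖F cu u∉F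
  region _         | yes fu = inF fu

  -- In the names of the mixed cases, b, f and c mark membership in B ∖ F, F and C ∖ F.
  data Triple (x y z : U) : Set where
    all-B : SB x → SB y → SB z → Triple x y z
    all-C : SC x → SC y → SC z → Triple x y z
    bbc : SB x → ¬ F x → SB y → ¬ F y → SC z → ¬ F z → Triple x y z
    bcb : SB x → ¬ F x → SC y → ¬ F y → SB z → ¬ F z → Triple x y z
    cbb : SC x → ¬ F x → SB y → ¬ F y → SB z → ¬ F z → Triple x y z
    bcc : SB x → ¬ F x → SC y → ¬ F y → SC z → ¬ F z → Triple x y z
    cbc : SC x → ¬ F x → SB y → ¬ F y → SC z → ¬ F z → Triple x y z
    ccb : SC x → ¬ F x → SC y → ¬ F y → SB z → ¬ F z → Triple x y z
    bfc : SB x → ¬ F x → F y → SC z → ¬ F z → Triple x y z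
    bcf : SB x → ¬ F x → SC y → ¬ F y → F z → Triple x y z
    fbc : F x → SB y → ¬ F y → SC z → ¬ F z → Triple x y z
    fcb : F x → SC y → ¬ F y → SB z → ¬ F z → Triple x y z
    cbf : SC x → ¬ F x → SB y → ¬ F y → F z → Triple x y z
    cfb : SC x → ¬ F x → F y → SB z → ¬ F z → Triple x y z

  triple : ∀ {x y z} → SD x → SD y → SD z → Triple x y z
  triple sx sy sz with region sx | region sy | region sz
  ... | inB∖F bx _ | inB∖F by _ | inB∖F bz _ = all-B bx by bz
  ... | inB∖F bx _ | inB∖F by _ | inF fz     = all-B bx by (F⊆B fz)
  ... | inB∖F bx _ | inF fy     | inB∖F bz _ = all-B bx (F⊆B fy) bz
  ... | inB∖F bx _ | inF fy     | inF fz     = all-B bx (F⊆B fy) (F⊆B fz)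
  ... | inF fx     | inB∖F by _ | inB∖F bz _ = all-B (F⊆B fx) by bz
  ... | inF fx     | inB∖F by _ | inF fz     = all-B (F⊆B fx) by (F⊆B fz)
  ... | inF fx     | inF fy     | inB∖F bz _ = all-B (F⊆B fx) (F⊆B fy) bz
  ... | inF fx     | inF fy     | inF fz     = all-B (F⊆B fx) (F⊆B fy) (F⊆B fz)
  ... | inC∖F cx _ | inC∖F cy _ | inC∖F cz _ = all-C cx cy cz
  ... | inC∖F cx _ | inC∖F cy _ | inF fz     = all-C cx cy (F⊆C fz)
  ... | inC∖F cx _ | inF fy     | inC∖F cz _ = all-C cx (F⊆C fy) cz
  ... | inC∖F cx _ | inF fy     | inF fz     = all-C cx (F⊆C fy) (F⊆C fz)
  ... | inF fx     | inC∖F cy _ | inC∖F cz _ = all-C (F⊆C fx) cy cz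
  ... | inF fx     | inC∖F cy _ | inF fz     = all-C (F⊆C fx) cy (F⊆C fz)
  ... | inF fx     | inF fy     | inC∖F cz _ = all-C (F⊆C fx) (F⊆C fy) cz
  ... | inB∖F bx nx | inB∖F by ny | inC∖F cz nz = bbc bx nx by ny cz nz
  ... | inB∖F bx nx | inC∖F cy ny | inB∖F bz nz = bcb bx nx cy ny bz nz
  ... | inC∖F cx nx | inB∖F by ny | inB∖F bz nz = cbb cx nx by ny bz nz
  ... | inB∖F bx nx | inC∖F cy ny | inC∖F cz nz = bcc bx nx cy ny cz nz
  ... | inC∖F cx nx | inB∖F by ny | inC∖F cz nz = cbc cx nx by ny cz nz
  ... | inC∖F cx nx | inC∖F cy ny | inB∖F bz nz = ccb cx nx cy ny bz nz
  ... | inB∖F bx nx | inF fy      | inC∖F cz nz = bfc bx nx fy cz nz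
  ... | inB∖F bx nx | inC∖F cy ny | inF fz      = bcf bx nx cy ny fz
  ... | inF fx      | inB∖F by ny | inC∖F cz nz = fbc fx by ny cz nz
  ... | inF fx      | inC∖F cy ny | inB∖F bz nz = fcb fx cy ny bz nz
  ... | inC∖F cx nx | inB∖F by ny | inF fz      = cbf cx nx by ny fz
  ... | inC∖F cx nx | inF fy      | inB∖F bz nz = cfb cx nx fy bz nz

  B-agree : ∀ {x y} → SB x → SB y →
              (x ∧ y ≡ x ∧ᴮ y) × (x · y ≡ x ·ᴮ y) × (x ⧵ y ≡ x ⧵ᴮ y) × (x / y ≡ x /ᴮ y)
  B-agree bx by = meet-B bx by , mul-B bx by , ldiv-B bx by , rdiv-B bx by

  C-agree : ∀ {x y} → SC x → SC y →
              (x ∧ y ≡ x ∧ᶜ y) × (x · y ≡ x ·ᶜ y) × (x ⧵ y ≡ x ⧵ᶜ y) × (x / y ≡ x /ᶜ y)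
  C-agree cx cy = meet-C cx cy , mul-C cx cy , ldiv-C cx cy , rdiv-C cx cy

  module OnB = Restriction irlB D B-agree
  module OnC = Restriction irlC D C-agree

  oneᴮ≡one : oneᴮ ≡ one
  oneᴮ≡one = begin
    oneᴮ          ≡⟨ sym (IC.integral (F⊆C FB.one∈F)) ⟩
    oneᴮ ∧ᶜ one   ≡⟨ sym (proj₁ (agree FB.one∈F FC.one∈F)) ⟩
    oneᴮ ∧ᴮ one   ≡⟨ IB.meet-comm IB.one-closed (F⊆B FC.one∈F) ⟩
    one ∧ᴮ oneᴮ   ≡⟨ IB.integral (F⊆B FC.one∈F) ⟩
    one           ∎
    where open ≡-Reasoning

  ≤-refl : ∀ {x} → SD x → x ≤ x
  ≤-refl (inj₁ bx) = OnB.≤′⇒≤ bx bx (PB.≤-refl bx)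
  ≤-refl (inj₂ cx) = OnC.≤′⇒≤ cx cx (PC.≤-refl cx)

  ≤one : ∀ {x} → SD x → x ≤ one
  ≤one {x} (inj₁ bx) = OnB.≤′⇒≤ bx (F⊆B FC.one∈F) (subst (x ≤ᴮ_) oneᴮ≡one (IB.integral bx))
  ≤one (inj₂ cx) = OnC.≤′⇒≤ cx IC.one-closed (IC.integral cx)

  B∖F≤C : ∀ {x y} → SB x → ¬ F x → SC y → x ≤ y
  B∖F≤C {x} {y} bx nx cy with lem {F y}
  ... | yes fy = OnB.≤′⇒≤ bx (F⊆B fy) (proj₁ (Cp.above fy bx nx))
  ... | no ny  = meet-BC bx nx cy ny

  C∖F≤F : ∀ {x f} → SC x → ¬ F x → F f → x ≤ f
  C∖F≤F cx nx ff = OnC.≤′⇒≤ cx (F⊆C ff) (proj₁ (aboveC ff cx nx))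

  C≤B⇒F : ∀ {x y} → SC x → SB y → x ≤ y → F y
  C≤B⇒F {x} {y} cx by x≤y with lem {F x} | lem {F y}
  ... | yes fx | _      = IsCongFilter.upset filterB fx by (OnB.≤⇒≤′ (F⊆B fx) by x≤y)
  ... | no _   | yes fy = fy
  ... | no nx  | no ny  = B∩C⊆F by (subst SC (trans (sym x≤y) (meet-CB cx nx by ny)) cx)

  ≤-antisym : ∀ {x y} → SD x → SD y → x ≤ y → y ≤ x → x ≡ y
  ≤-antisym sx sy x≤y y≤x with pair sx sy
  ... | both-B bx by = PB.≤-antisym bx by (OnB.≤⇒≤′ bx by x≤y) (OnB.≤⇒≤′ by bx y≤x)
  ... | both-C cx cy = PC.≤-antisym cx cy (OnC.≤⇒≤′ cx cy x≤y) (OnC.≤⇒≤′ cy cx y≤x)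
  ... | B-C bx nx cy _ = ⊥-elim (nx (C≤B⇒F cy bx y≤x))
  ... | C-B cx _ by ny = ⊥-elim (ny (C≤B⇒F cx by x≤y))

  ≤-trans : ∀ {x y z} → SD x → SD y → SD z → x ≤ y → y ≤ z → x ≤ z
  ≤-trans sx sy sz x≤y y≤z with triple sx sy sz
  ... | all-B bx by bz =
    OnB.≤′⇒≤ bx bz (PB.≤-trans bx by bz (OnB.≤⇒≤′ bx by x≤y) (OnB.≤⇒≤′ by bz y≤z))
  ... | all-C cx cy cz =
    OnC.≤′⇒≤ cx cz (PC.≤-trans cx cy cz (OnC.≤⇒≤′ cx cy x≤y) (OnC.≤⇒≤′ cy cz y≤z))
  ... | bbc bx nx _ _ cz _ = B∖F≤C bx nx cz
  ... | bcc bx nx _ _ cz _ = B∖F≤C bx nx cz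
  ... | bfc bx nx _ cz _   = B∖F≤C bx nx cz
  ... | bcf bx nx _ _ fz   = B∖F≤C bx nx (F⊆C fz)
  ... | bcb _ _ cy _ bz nz = ⊥-elim (nz (C≤B⇒F cy bz y≤z))
  ... | ccb _ _ cy _ bz nz = ⊥-elim (nz (C≤B⇒F cy bz y≤z))
  ... | fcb _ cy _ bz nz   = ⊥-elim (nz (C≤B⇒F cy bz y≤z))
  ... | cfb _ _ fy bz nz   = ⊥-elim (nz (C≤B⇒F (F⊆C fy) bz y≤z))
  ... | cbb cx _ by ny _ _ = ⊥-elim (ny (C≤B⇒F cx by x≤y))
  ... | cbc cx _ by ny _ _ = ⊥-elim (ny (C≤B⇒F cx by x≤y))
  ... | cbf cx _ by ny _   = ⊥-elim (ny (C≤B⇒F cx by x≤y))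
  ... | fbc fx by ny _ _   = ⊥-elim (ny (C≤B⇒F (F⊆C fx) by x≤y))

  meet-closed : ∀ {x y} → SD x → SD y → SD (x ∧ y)
  meet-closed sx sy with pair sx sy
  ... | both-B bx by rewrite meet-B bx by = inj₁ (IB.meet-closed bx by)
  ... | both-C cx cy rewrite meet-C cx cy = inj₂ (IC.meet-closed cx cy)
  ... | B-C bx nx cy ny rewrite meet-BC bx nx cy ny = inj₁ bx
  ... | C-B cx nx by ny rewrite meet-CB cx nx by ny = inj₁ by

  join-closed : ∀ {x y} → SD x → SD y → SD (x ∨ y)
  join-closed {x} {y} sx sy with pair sx sy
  ... | both-C cx cy rewrite join-C cx cy = inj₂ (IC.join-closed cx cy)
  ... | B-C bx nx cy ny rewrite join-BC bx nx cy ny = inj₂ cy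
  ... | C-B cx nx by ny rewrite join-CB cx nx by ny = inj₂ cx
  ... | both-B bx by with lem {Escapes x y}
  ...   | yes e = inj₂ (proj₁ (join-B-escapes e))
  ...   | no ne rewrite join-B-ordinary bx by ne = inj₁ (IB.join-closed bx by)

  meet≤ˡ : ∀ {x y} → SD x → SD y → x ∧ y ≤ x
  meet≤ˡ sx sy with pair sx sy
  ... | both-B bx by rewrite meet-B bx by = OnB.≤′⇒≤ (IB.meet-closed bx by) bx (PB.meet≤ˡ bx by)
  ... | both-C cx cy rewrite meet-C cx cy = OnC.≤′⇒≤ (IC.meet-closed cx cy) cx (PC.meet≤ˡ cx cy)
  ... | B-C bx nx cy ny rewrite meet-BC bx nx cy ny = ≤-refl sx
  ... | C-B cx nx by ny rewrite meet-CB cx nx by ny = B∖F≤C by ny cx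

  meet≤ʳ : ∀ {x y} → SD x → SD y → x ∧ y ≤ y
  meet≤ʳ sx sy with pair sx sy
  ... | both-B bx by rewrite meet-B bx by = OnB.≤′⇒≤ (IB.meet-closed bx by) by (PB.meet≤ʳ bx by)
  ... | both-C cx cy rewrite meet-C cx cy = OnC.≤′⇒≤ (IC.meet-closed cx cy) cy (PC.meet≤ʳ cx cy)
  ... | B-C bx nx cy ny rewrite meet-BC bx nx cy ny = B∖F≤C bx nx cy
  ... | C-B cx nx by ny rewrite meet-CB cx nx by ny = ≤-refl sy

  meet-greatest-B : ∀ {x y z} → SB x → SB y → SB z → z ≤ x → z ≤ y → z ≤ x ∧ y
  meet-greatest-B bx by bz z≤x z≤y rewrite meet-B bx by = OnB.≤′⇒≤ bz (IB.meet-closed bx by)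
    (PB.meet-greatest bx by bz (OnB.≤⇒≤′ bz bx z≤x) (OnB.≤⇒≤′ bz by z≤y))

  meet-greatest-C : ∀ {x y z} → SC x → SC y → SC z → z ≤ x → z ≤ y → z ≤ x ∧ y
  meet-greatest-C cx cy cz z≤x z≤y rewrite meet-C cx cy = OnC.≤′⇒≤ cz (IC.meet-closed cx cy)
    (PC.meet-greatest cx cy cz (OnC.≤⇒≤′ cz cx z≤x) (OnC.≤⇒≤′ cz cy z≤y))

  meet-greatest : ∀ {x y z} → SD x → SD y → SD z → z ≤ x → z ≤ y → z ≤ x ∧ y
  meet-greatest sx sy sz z≤x z≤y with pair sx sy | region sz
  ... | B-C bx nx cy ny | _ rewrite meet-BC bx nx cy ny = z≤x
  ... | C-B cx nx by ny | _ rewrite meet-CB cx nx by ny = z≤y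
  ... | both-C cx cy | inB∖F bz nz rewrite meet-C cx cy = B∖F≤C bz nz (IC.meet-closed cx cy)
  ... | both-C cx cy | inF fz = meet-greatest-C cx cy (F⊆C fz) z≤x z≤y
  ... | both-C cx cy | inC∖F cz _ = meet-greatest-C cx cy cz z≤x z≤y
  ... | both-B bx by | inB∖F bz _ = meet-greatest-B bx by bz z≤x z≤y
  ... | both-B bx by | inF fz = meet-greatest-B bx by (F⊆B fz) z≤x z≤y
  ... | both-B bx by | inC∖F cz _ = meet-greatest-C (F⊆C fx) (F⊆C fy) cz z≤x z≤y
    where fx = C≤B⇒F cz bx z≤x
          fy = C≤B⇒F cz by z≤y

  ≤joinˡ : ∀ {x y} → SD x → SD y → x ≤ x ∨ y
  ≤joinˡ {x} {y} sx sy with pair sx sy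
  ... | both-C cx cy rewrite join-C cx cy = OnC.≤′⇒≤ cx (IC.join-closed cx cy) (PC.≤joinˡ cx cy)
  ... | B-C bx nx cy ny rewrite join-BC bx nx cy ny = B∖F≤C bx nx cy
  ... | C-B cx nx by ny rewrite join-CB cx nx by ny = ≤-refl sx
  ... | both-B bx by with lem {Escapes x y}
  ...   | yes e@(_ , nx , _) = B∖F≤C bx nx (proj₁ (join-B-escapes e))
  ...   | no ne rewrite join-B-ordinary bx by ne =
          OnB.≤′⇒≤ bx (IB.join-closed bx by) (PB.≤joinˡ bx by)

  ≤joinʳ : ∀ {x y} → SD x → SD y → y ≤ x ∨ y
  ≤joinʳ {x} {y} sx sy with pair sx sy
  ... | both-C cx cy rewrite join-C cx cy = OnC.≤′⇒≤ cy (IC.join-closed cx cy) (PC.≤joinʳ cx cy)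
  ... | B-C bx nx cy ny rewrite join-BC bx nx cy ny = ≤-refl sy
  ... | C-B cx nx by ny rewrite join-CB cx nx by ny = B∖F≤C by ny cx
  ... | both-B bx by with lem {Escapes x y}
  ...   | yes e@(_ , _ , _ , ny , _) = B∖F≤C by ny (proj₁ (join-B-escapes e))
  ...   | no ne rewrite join-B-ordinary bx by ne =
          OnB.≤′⇒≤ by (IB.join-closed bx by) (PB.≤joinʳ bx by)

  join-least-C : ∀ {x y z} → SC x → SC y → SC z → x ≤ z → y ≤ z → x ∨ y ≤ z
  join-least-C cx cy cz x≤z y≤z rewrite join-C cx cy = OnC.≤′⇒≤ (IC.join-closed cx cy) cz
    (PC.join-least cx cy cz (OnC.≤⇒≤′ cx cz x≤z) (OnC.≤⇒≤′ cy cz y≤z))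

  join-least-B : ∀ {x y z} → SB x → SB y → SB z → ¬ Escapes x y → x ≤ z → y ≤ z → x ∨ y ≤ z
  join-least-B bx by bz ne x≤z y≤z rewrite join-B-ordinary bx by ne = OnB.≤′⇒≤ (IB.join-closed bx by) bz
    (PB.join-least bx by bz (OnB.≤⇒≤′ bx bz x≤z) (OnB.≤⇒≤′ by bz y≤z))

  join-least-escaped : ∀ {x y z} → Escapes x y → SC z → x ∨ y ≤ z
  join-least-escaped {z = z} e cz =
    OnC.≤′⇒≤ (proj₁ (join-B-escapes e)) cz (proj₂ (join-B-escapes e) z cz)

  join-least : ∀ {x y z} → SD x → SD y → SD z → x ≤ z → y ≤ z → x ∨ y ≤ z
  join-least {x} {y} {z} sx sy sz x≤z y≤z with pair sx sy | region sz
  ... | B-C bx nx cy ny | _ rewrite join-BC bx nx cy ny = y≤z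
  ... | C-B cx nx by ny | _ rewrite join-CB cx nx by ny = x≤z
  ... | both-C cx cy | inB∖F bz nz = ⊥-elim (nz (C≤B⇒F cx bz x≤z))
  ... | both-C cx cy | inF fz = join-least-C cx cy (F⊆C fz) x≤z y≤z
  ... | both-C cx cy | inC∖F cz _ = join-least-C cx cy cz x≤z y≤z
  ... | both-B bx by | rz with lem {Escapes x y} | rz
  ...   | yes e | inF fz = join-least-escaped e (F⊆C fz)
  ...   | yes e | inC∖F cz _ = join-least-escaped e cz
  ...   | yes e@(_ , _ , _ , _ , x∨ᴮy∈F) | inB∖F bz nz = ⊥-elim (nz (IsCongFilter.upset filterB x∨ᴮy∈F bz
            (PB.join-least bx by bz (OnB.≤⇒≤′ bx bz x≤z) (OnB.≤⇒≤′ by bz y≤z))))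
  ...   | no ne | inB∖F bz _ = join-least-B bx by bz ne x≤z y≤z
  ...   | no ne | inF fz = join-least-B bx by (F⊆B fz) ne x≤z y≤z
  ...   | no ne | inC∖F cz nz rewrite join-B-ordinary bx by ne =
          B∖F≤C (IB.join-closed bx by) (λ x∨ᴮy∈F → ne (bx , below-C∖F x≤z , by , below-C∖F y≤z , x∨ᴮy∈F)) cz
    where
    below-C∖F : ∀ {w} → w ≤ z → ¬ F w
    below-C∖F w≤z fw = nz (IsCongFilter.upset filterC fw cz (OnC.≤⇒≤′ (F⊆C fw) cz w≤z))

  latticeOrder : IsLatticeOrder SD D
  latticeOrder = record
    { meet-closed = meet-closed ; join-closed = join-closed
    ; ≤-refl = ≤-refl ; ≤-antisym = ≤-antisym ; ≤-trans = ≤-trans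
    ; meet≤ˡ = meet≤ˡ ; meet≤ʳ = meet≤ʳ ; meet-greatest = meet-greatest
    ; ≤joinˡ = ≤joinˡ ; ≤joinʳ = ≤joinʳ ; join-least = join-least
    }

  -- Multiplication

  mul-closed : ∀ {x y} → SD x → SD y → SD (x · y)
  mul-closed sx sy with pair sx sy
  ... | both-B bx by rewrite mul-B bx by = inj₁ (IB.mul-closed bx by)
  ... | both-C cx cy rewrite mul-C cx cy = inj₂ (IC.mul-closed cx cy)
  ... | B-C bx nx cy ny = inj₁ (proj₁ (mul-BC bx nx cy ny))
  ... | C-B cx nx by ny = inj₁ (proj₁ (mul-CB cx nx by ny))

  ldiv-closed : ∀ {x y} → SD x → SD y → SD (x ⧵ y)
  ldiv-closed sx sy with pair sx sy
  ... | both-B bx by rewrite ldiv-B bx by = inj₁ (IB.ldiv-closed bx by)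
  ... | both-C cx cy rewrite ldiv-C cx cy = inj₂ (IC.ldiv-closed cx cy)
  ... | B-C bx nx cy ny rewrite ldiv-BC bx nx cy ny = inj₂ IC.one-closed
  ... | C-B cx nx by ny = inj₁ (proj₁ (ldiv-CB cx nx by ny))

  rdiv-closed : ∀ {x y} → SD x → SD y → SD (x / y)
  rdiv-closed sx sy with pair sx sy
  ... | both-B bx by rewrite rdiv-B bx by = inj₁ (IB.rdiv-closed bx by)
  ... | both-C cx cy rewrite rdiv-C cx cy = inj₂ (IC.rdiv-closed cx cy)
  ... | B-C bx nx cy ny = inj₁ (proj₁ (rdiv-BC bx nx cy ny))
  ... | C-B cx nx by ny rewrite rdiv-CB cx nx by ny = inj₂ IC.one-closed

  one-left : ∀ {x} → SD x → one · x ≡ x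
  one-left {x} (inj₁ bx) = begin
    one · x       ≡⟨ mul-B (F⊆B FC.one∈F) bx ⟩
    one ·ᴮ x      ≡⟨ cong (_·ᴮ x) (sym oneᴮ≡one) ⟩
    oneᴮ ·ᴮ x     ≡⟨ IB.one-left bx ⟩
    x             ∎
    where open ≡-Reasoning
  one-left (inj₂ cx) = trans (mul-C IC.one-closed cx) (IC.one-left cx)

  one-right : ∀ {x} → SD x → x · one ≡ x
  one-right {x} (inj₁ bx) = begin
    x · one       ≡⟨ mul-B bx (F⊆B FC.one∈F) ⟩
    x ·ᴮ one      ≡⟨ cong (x ·ᴮ_) (sym oneᴮ≡one) ⟩
    x ·ᴮ oneᴮ     ≡⟨ IB.one-right bx ⟩
    x             ∎
    where open ≡-Reasoning
  one-right (inj₂ cx) = trans (mul-C cx IC.one-closed) (IC.one-right cx)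

  mul-∈B : ∀ {x y} → SB x → SB y → SB (x · y)
  mul-∈B bx by = subst SB (sym (mul-B bx by)) (IB.mul-closed bx by)

  mul-∈C : ∀ {x y} → SC x → SC y → SC (x · y)
  mul-∈C cx cy = subst SC (sym (mul-C cx cy)) (IC.mul-closed cx cy)

  ∉F-mulˡ-B : ∀ {x y} → SB x → SB y → ¬ F x → ¬ F (x · y)
  ∉F-mulˡ-B bx by nx = subst (λ w → ¬ F w) (sym (mul-B bx by)) (FB.∉F-mulˡ bx by nx)

  ∉F-mulʳ-B : ∀ {x y} → SB x → SB y → ¬ F y → ¬ F (x · y)
  ∉F-mulʳ-B bx by ny = subst (λ w → ¬ F w) (sym (mul-B bx by)) (FB.∉F-mulʳ bx by ny)

  ∉F-mulˡ-C : ∀ {x y} → SC x → SC y → ¬ F x → ¬ F (x · y)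
  ∉F-mulˡ-C cx cy nx = subst (λ w → ¬ F w) (sym (mul-C cx cy)) (FC.∉F-mulˡ cx cy nx)

  ∉F-mulʳ-C : ∀ {x y} → SC x → SC y → ¬ F y → ¬ F (x · y)
  ∉F-mulʳ-C cx cy ny = subst (λ w → ¬ F w) (sym (mul-C cx cy)) (FC.∉F-mulʳ cx cy ny)

  min-mulˡ : ∀ {x y s} → SB x → ¬ F x → SB y → ¬ F y → IsMinClass y s → IsMinClass (x · y) (x · s)
  min-mulˡ {x} {y} {s} bx nx by ny ys@(bs , y≈s , _) with Cp.σ-left bx nx by ny ys
  ... | a , ba , _ , a-min@(bxs , a≈xs , _) rewrite mul-B bx by | mul-B bx bs =
    FB.min-transfer ba bxy (FB.θ-trans ba bxs bxy a≈xs (FB.θ-mulˡ bs by bx (FB.θ-sym y≈s))) a-min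
    where bxy = IB.mul-closed bx by

  min-mulʳ : ∀ {x y s} → SB x → ¬ F x → IsMinClass x s → SB y → ¬ F y → IsMinClass (x · y) (s · y)
  min-mulʳ {x} {y} {s} bx nx xs@(bs , x≈s , _) by ny with Cp.σ-right by ny bx nx xs
  ... | a , ba , _ , a-min@(bsy , a≈sy , _) rewrite mul-B bx by | mul-B bs by =
    FB.min-transfer ba bxy (FB.θ-trans ba bsy bxy a≈sy (FB.θ-mulʳ bs bx by (FB.θ-sym x≈s))) a-min
    where bxy = IB.mul-closed bx by

  min-mul-C : ∀ {a m c} → SB a → ¬ F a → IsMinClass a m → SC c → ¬ F c → IsMinClass a (m · c)
  min-mul-C {a} ba na am@(bm , _) cc nc =
    subst (IsMinClass a) (FB.min-unique (FB.min-idem ba am) (mul-BC bm (FB.min-∉F ba am na) cc nc)) am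

  min-C-mul : ∀ {a m c} → SB a → ¬ F a → IsMinClass a m → SC c → ¬ F c → IsMinClass a (c · m)
  min-C-mul {a} ba na am@(bm , _) cc nc =
    subst (IsMinClass a) (FB.min-unique (FB.min-idem ba am) (mul-CB cc nc bm (FB.min-∉F ba am na))) am

  min-mul-F : ∀ {a m f} → SB a → IsMinClass a m → F f → IsMinClass a (m · f)
  min-mul-F {a} ba am@(bm , _) ff =
    subst (IsMinClass a) (sym (trans (mul-B bm (F⊆B ff)) (FB.min-absorbʳ ba am ff))) am

  min-F-mul : ∀ {a m f} → SB a → IsMinClass a m → F f → IsMinClass a (f · m)
  min-F-mul {a} ba am@(bm , _) ff =
    subst (IsMinClass a) (sym (trans (mul-B (F⊆B ff) bm) (FB.min-absorbˡ ba am ff))) am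

  min-of-mul-F : ∀ {w f m} → SB w → F f → IsMinClass (w · f) m → IsMinClass w m
  min-of-mul-F bw ff rewrite mul-B bw (F⊆B ff) =
    FB.min-transfer (IB.mul-closed bw (F⊆B ff)) bw (FB.F-mulʳ-θ ff bw)

  min-of-F-mul : ∀ {w f m} → F f → SB w → IsMinClass (f · w) m → IsMinClass w m
  min-of-F-mul ff bw rewrite mul-B (F⊆B ff) bw =
    FB.min-transfer (IB.mul-closed (F⊆B ff) bw) bw (FB.F-mulˡ-θ ff bw)

  mul-assoc : ∀ {x y z} → SD x → SD y → SD z → (x · y) · z ≡ x · (y · z)
  mul-assoc sx sy sz with triple sx sy sz
  ... | all-B bx by bz = OnB.mul-assoc′ bx by bz
  ... | all-C cx cy cz = OnC.mul-assoc′ cx cy cz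
  ... | bbc bx nx by ny cz nz = FB.min-unique
    (mul-BC (mul-∈B bx by) (∉F-mulˡ-B bx by nx) cz nz)
    (min-mulˡ bx nx by ny (mul-BC by ny cz nz))
  ... | bcb bx nx cy ny bz nz = FB.min-unique
    (min-mulʳ bx nx (mul-BC bx nx cy ny) bz nz)
    (min-mulˡ bx nx bz nz (mul-CB cy ny bz nz))
  ... | cbb cx nx by ny bz nz = FB.min-unique
    (min-mulʳ by ny (mul-CB cx nx by ny) bz nz)
    (mul-CB cx nx (mul-∈B by bz) (∉F-mulˡ-B by bz ny))
  ... | bcc bx nx cy ny cz nz = FB.min-unique
    (min-mul-C bx nx (mul-BC bx nx cy ny) cz nz)
    (mul-BC bx nx (mul-∈C cy cz) (∉F-mulˡ-C cy cz ny))
  ... | cbc cx nx by ny cz nz = FB.min-unique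
    (min-mul-C by ny (mul-CB cx nx by ny) cz nz)
    (min-C-mul by ny (mul-BC by ny cz nz) cx nx)
  ... | ccb cx nx cy ny bz nz = FB.min-unique
    (mul-CB (mul-∈C cx cy) (∉F-mulˡ-C cx cy nx) bz nz)
    (min-C-mul bz nz (mul-CB cy ny bz nz) cx nx)
  ... | bfc bx nx fy cz nz = FB.min-unique
    (min-of-mul-F bx fy (mul-BC (mul-∈B bx (F⊆B fy)) (∉F-mulˡ-B bx (F⊆B fy) nx) cz nz))
    (mul-BC bx nx (mul-∈C (F⊆C fy) cz) (∉F-mulʳ-C (F⊆C fy) cz nz))
  ... | bcf bx nx cy ny fz = FB.min-unique
    (min-mul-F bx (mul-BC bx nx cy ny) fz)
    (mul-BC bx nx (mul-∈C cy (F⊆C fz)) (∉F-mulˡ-C cy (F⊆C fz) ny))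
  ... | fbc fx by ny cz nz = FB.min-unique
    (min-of-F-mul fx by (mul-BC (mul-∈B (F⊆B fx) by) (∉F-mulʳ-B (F⊆B fx) by ny) cz nz))
    (min-F-mul by (mul-BC by ny cz nz) fx)
  ... | fcb fx cy ny bz nz = FB.min-unique
    (mul-CB (mul-∈C (F⊆C fx) cy) (∉F-mulʳ-C (F⊆C fx) cy ny) bz nz)
    (min-F-mul bz (mul-CB cy ny bz nz) fx)
  ... | cbf cx nx by ny fz = FB.min-unique
    (min-mul-F by (mul-CB cx nx by ny) fz)
    (min-of-mul-F by fz (mul-CB cx nx (mul-∈B by (F⊆B fz)) (∉F-mulˡ-B by (F⊆B fz) ny)))
  ... | cfb cx nx fy bz nz = FB.min-unique
    (mul-CB (mul-∈C cx (F⊆C fy)) (∉F-mulˡ-C cx (F⊆C fy) nx) bz nz)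
    (min-of-F-mul fy bz (mul-CB cx nx (mul-∈B (F⊆B fy) bz) (∉F-mulʳ-B (F⊆B fy) bz nz)))

  -- Residuation

  ldiv-∈C : ∀ {x y} → SC x → SC y → SC (x ⧵ y)
  ldiv-∈C cx cy = subst SC (sym (ldiv-C cx cy)) (IC.ldiv-closed cx cy)

  rdiv-∈C : ∀ {x y} → SC x → SC y → SC (x / y)
  rdiv-∈C cx cy = subst SC (sym (rdiv-C cx cy)) (IC.rdiv-closed cx cy)

  C∖F≤B⇔F : ∀ {y w} → SC y → ¬ F y → SB w → (y ≤ w) ⇔ F w
  C∖F≤B⇔F cy ny bw = mk⇔ (C≤B⇒F cy bw) (C∖F≤F cy ny)

  min≤⇔ldiv∈F : ∀ {x s z} → SB x → IsMinClass x s → SB z → (s ≤ z) ⇔ F (x ⧵ᴮ z)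
  min≤⇔ldiv∈F bx xs@(bs , _) bz = mk⇔
    (λ s≤z → FB.min≤⇒ldiv∈F bx xs bz (OnB.≤⇒≤′ bs bz s≤z))
    (λ x⧵z∈F → OnB.≤′⇒≤ bs bz (FB.ldiv∈F⇒min≤ bx xs bz x⧵z∈F))

  min≤⇔rdiv∈F : ∀ {y s z} → SB y → IsMinClass y s → SB z → (s ≤ z) ⇔ F (z /ᴮ y)
  min≤⇔rdiv∈F by ys@(bs , _) bz = mk⇔
    (λ s≤z → FB.min≤⇒rdiv∈F by ys bz (OnB.≤⇒≤′ bs bz s≤z))
    (λ z/y∈F → OnB.≤′⇒≤ bs bz (FB.rdiv∈F⇒min≤ by ys bz z/y∈F))

  min≤⇔≤max : ∀ {y s z g} → SB y → IsMinClass y s → SB z → IsMaxClass z g → (s ≤ z) ⇔ (y ≤ g)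
  min≤⇔≤max by ys@(bs , _) bz zg@(bg , _) = mk⇔
    (λ s≤z → OnB.≤′⇒≤ by bg (FB.min≤⇒≤max by ys bz zg (OnB.≤⇒≤′ bs bz s≤z)))
    (λ y≤g → OnB.≤′⇒≤ bs bz (FB.≤max⇒min≤ by ys bz zg (OnB.≤⇒≤′ by bg y≤g)))

  B∖F-mul≤C : ∀ {x y z} → SB x → SB y → ¬ F (x ·ᴮ y) → SC z → x · y ≤ z
  B∖F-mul≤C bx by nxy cz rewrite mul-B bx by = B∖F≤C (IB.mul-closed bx by) nxy cz

  min≤C : ∀ {a m z} → SB a → ¬ F a → IsMinClass a m → SC z → m ≤ z
  min≤C ba na am@(bm , _) cz = B∖F≤C bm (FB.min-∉F ba am na) cz

  C-mul≰B∖F : ∀ {x y z} → SC x → SC y → SB z → ¬ F z → ¬ (x · y ≤ z)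
  C-mul≰B∖F cx cy bz nz xy≤z = nz (C≤B⇒F (mul-∈C cx cy) bz xy≤z)

  C≰max : ∀ {x z g} → SC x → SB z → ¬ F z → IsMaxClass z g → ¬ (x ≤ g)
  C≰max cx bz nz zg@(bg , _) x≤g = FB.max-∉F bz zg nz (C≤B⇒F cx bg x≤g)

  residuationˡ : ∀ {x y z} → SD x → SD y → SD z → (x · y ≤ z) ⇔ (y ≤ x ⧵ z)
  residuationˡ sx sy sz with triple sx sy sz
  ... | all-B bx by bz = OnB.residuationˡ bx by bz
  ... | all-C cx cy cz = OnC.residuationˡ cx cy cz
  ... | bbc bx nx by ny cz nz rewrite ldiv-BC bx nx cz nz =
    ⇔-both (B∖F-mul≤C bx by (FB.∉F-mulˡ bx by nx) cz) (≤one sy)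
  ... | bfc bx nx fy cz nz rewrite ldiv-BC bx nx cz nz =
    ⇔-both (B∖F-mul≤C bx (F⊆B fy) (FB.∉F-mulˡ bx (F⊆B fy) nx) cz) (≤one sy)
  ... | bcb bx nx cy ny bz nz rewrite ldiv-B bx bz =
    ⇔-sym (C∖F≤B⇔F cy ny (IB.ldiv-closed bx bz)) ⇔-∘ min≤⇔ldiv∈F bx (mul-BC bx nx cy ny) bz
  ... | cbb cx nx by ny bz nz = min≤⇔≤max by (mul-CB cx nx by ny) bz (ldiv-CB cx nx bz nz)
  ... | bcc bx nx cy ny cz nz rewrite ldiv-BC bx nx cz nz =
    ⇔-both (min≤C bx nx (mul-BC bx nx cy ny) cz) (≤one sy)
  ... | cbc cx nx by ny cz nz =
    ⇔-both (min≤C by ny (mul-CB cx nx by ny) cz) (B∖F≤C by ny (ldiv-∈C cx cz))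
  ... | cbf cx nx by ny fz =
    ⇔-both (min≤C by ny (mul-CB cx nx by ny) (F⊆C fz)) (B∖F≤C by ny (ldiv-∈C cx (F⊆C fz)))
  ... | ccb cx nx cy ny bz nz =
    ⇔-neither (C-mul≰B∖F cx cy bz nz) (C≰max cy bz nz (ldiv-CB cx nx bz nz))
  ... | cfb cx nx fy bz nz =
    ⇔-neither (C-mul≰B∖F cx (F⊆C fy) bz nz) (C≰max (F⊆C fy) bz nz (ldiv-CB cx nx bz nz))
  ... | bcf bx nx cy ny fz rewrite ldiv-B bx (F⊆B fz) =
    ⇔-both (min≤C bx nx (mul-BC bx nx cy ny) (F⊆C fz))
           (C∖F≤F cy ny (FB.≤⇒ldiv∈F bx (F⊆B fz) (proj₁ (Cp.above fz bx nx))))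
  ... | fbc fx by ny cz nz =
    ⇔-both (B∖F-mul≤C (F⊆B fx) by (FB.∉F-mulʳ (F⊆B fx) by ny) cz) (B∖F≤C by ny (ldiv-∈C (F⊆C fx) cz))
  ... | fcb fx cy ny bz nz rewrite ldiv-B (F⊆B fx) bz =
    ⇔-neither (C-mul≰B∖F (F⊆C fx) cy bz nz)
              (λ y≤x⧵z → nz (FB.ldiv-mp fx (C≤B⇒F cy (IB.ldiv-closed (F⊆B fx) bz) y≤x⧵z) bz))

  residuationʳ : ∀ {x y z} → SD x → SD y → SD z → (x · y ≤ z) ⇔ (x ≤ z / y)
  residuationʳ sx sy sz with triple sx sy sz
  ... | all-B bx by bz = OnB.residuationʳ bx by bz
  ... | all-C cx cy cz = OnC.residuationʳ cx cy cz
  ... | bbc bx nx by ny cz nz rewrite rdiv-CB cz nz by ny =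
    ⇔-both (B∖F-mul≤C bx by (FB.∉F-mulˡ bx by nx) cz) (≤one sx)
  ... | bfc bx nx fy cz nz =
    ⇔-both (B∖F-mul≤C bx (F⊆B fy) (FB.∉F-mulˡ bx (F⊆B fy) nx) cz) (B∖F≤C bx nx (rdiv-∈C cz (F⊆C fy)))
  ... | bcb bx nx cy ny bz nz = min≤⇔≤max bx (mul-BC bx nx cy ny) bz (rdiv-BC bz nz cy ny)
  ... | cbb cx nx by ny bz nz rewrite rdiv-B bz by =
    ⇔-sym (C∖F≤B⇔F cx nx (IB.rdiv-closed bz by)) ⇔-∘ min≤⇔rdiv∈F by (mul-CB cx nx by ny) bz
  ... | bcc bx nx cy ny cz nz =
    ⇔-both (min≤C bx nx (mul-BC bx nx cy ny) cz) (B∖F≤C bx nx (rdiv-∈C cz cy))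
  ... | cbc cx nx by ny cz nz rewrite rdiv-CB cz nz by ny =
    ⇔-both (min≤C by ny (mul-CB cx nx by ny) cz) (≤one sx)
  ... | cbf cx nx by ny fz rewrite rdiv-B (F⊆B fz) by =
    ⇔-both (min≤C by ny (mul-CB cx nx by ny) (F⊆C fz))
           (C∖F≤F cx nx (FB.≤⇒rdiv∈F by (F⊆B fz) (proj₁ (Cp.above fz by ny))))
  ... | ccb cx nx cy ny bz nz =
    ⇔-neither (C-mul≰B∖F cx cy bz nz) (C≰max cx bz nz (rdiv-BC bz nz cy ny))
  ... | cfb cx nx fy bz nz rewrite rdiv-B bz (F⊆B fy) =
    ⇔-neither (C-mul≰B∖F cx (F⊆C fy) bz nz)
              (λ x≤z/y → nz (FB.rdiv-mp (C≤B⇒F cx (IB.rdiv-closed bz (F⊆B fy)) x≤z/y) fy bz))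
  ... | bcf bx nx cy ny fz =
    ⇔-both (min≤C bx nx (mul-BC bx nx cy ny) (F⊆C fz)) (B∖F≤C bx nx (rdiv-∈C (F⊆C fz) cy))
  ... | fbc fx by ny cz nz rewrite rdiv-CB cz nz by ny =
    ⇔-both (B∖F-mul≤C (F⊆B fx) by (FB.∉F-mulʳ (F⊆B fx) by ny) cz) (≤one sx)
  ... | fcb fx cy ny bz nz =
    ⇔-neither (C-mul≰B∖F (F⊆C fx) cy bz nz) (C≰max (F⊆C fx) bz nz (rdiv-BC bz nz cy ny))

  ⊕-isIRL : IsIRL SD D
  ⊕-isIRL = record
    { meet-closed = meet-closed ; join-closed = join-closed ; mul-closed = mul-closed
    ; ldiv-closed = ldiv-closed ; rdiv-closed = rdiv-closed ; one-closed = inj₂ IC.one-closed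
    ; meet-comm = L.meet-comm ; join-comm = L.join-comm
    ; meet-assoc = L.meet-assoc ; join-assoc = L.join-assoc
    ; meet-absorb = L.meet-absorb ; join-absorb = L.join-absorb
    ; mul-assoc = mul-assoc ; one-left = one-left ; one-right = one-right
    ; res-ldiv-to = λ sx sy sz → Equivalence.to (residuationˡ sx sy sz)
    ; res-ldiv-from = λ sx sy sz → Equivalence.from (residuationˡ sx sy sz)
    ; res-rdiv-to = λ sx sy sz → Equivalence.to (residuationʳ sx sy sz)
    ; res-rdiv-from = λ sx sy sz → Equivalence.from (residuationʳ sx sy sz)
    ; integral = ≤one
    }
    where module L = IsLatticeOrder latticeOrder

  F-isCongFilter : IsCongFilter SD D F
  F-isCongFilter = record
    { subset = λ fx → inj₁ (F⊆B fx)
    ; nonempty = CFB.nonempty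
    ; upset = upset
    ; mul-closed = λ fx fy → subst F (sym (mul-B (F⊆B fx) (F⊆B fy))) (CFB.mul-closed fx fy)
    ; conj-right = conj-right
    ; conj-left = conj-left
    }
    where
    module CFB = IsCongFilter filterB
    module CFC = IsCongFilter filterC

    upset : ∀ {x y} → F x → SD y → x ≤ y → F y
    upset fx (inj₁ by) x≤y = CFB.upset fx by (OnB.≤⇒≤′ (F⊆B fx) by x≤y)
    upset fx (inj₂ cy) x≤y = CFC.upset fx cy (OnC.≤⇒≤′ (F⊆C fx) cy x≤y)

    conj-right : ∀ {x y} → F x → SD y → F ((y · x) / y)
    conj-right fx (inj₁ by)
      rewrite mul-B by (F⊆B fx) | rdiv-B (IB.mul-closed by (F⊆B fx)) by = CFB.conj-right fx by
    conj-right fx (inj₂ cy)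
      rewrite mul-C cy (F⊆C fx) | rdiv-C (IC.mul-closed cy (F⊆C fx)) cy = CFC.conj-right fx cy

    conj-left : ∀ {x y} → F x → SD y → F (y ⧵ (x · y))
    conj-left fx (inj₁ by)
      rewrite mul-B (F⊆B fx) by | ldiv-B by (IB.mul-closed (F⊆B fx) by) = CFB.conj-left fx by
    conj-left fx (inj₂ cy)
      rewrite mul-C (F⊆C fx) cy | ldiv-C cy (IC.mul-closed (F⊆C fx) cy) = CFC.conj-left fx cy

  B∖F<C∖F : ∀ {x y} → SB x → ¬ F x → SC y → ¬ F y → x < y
  B∖F<C∖F bx nx cy _ = B∖F≤C bx nx cy , λ x≡y → nx (B∩C⊆F bx (subst SC (sym x≡y) cy))

  C∖F<F : ∀ {x f} → SC x → ¬ F x → F f → x < f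
  C∖F<F cx nx ff = C∖F≤F cx nx ff , λ x≡f → nx (subst F (sym x≡f) ff)

  B-join : (∀ {x y} → SB x → SB y → x ∨ y ≡ x ∨ᴮ y) ⊎ (Σ U λ f → F f × (∀ g → F g → f ≤ g))
  B-join with lem {JoinEscapes SB B F}
  ... | yes (x , y , bx , nx , by , ny , x∨ᴮy∈F) = inj₂ (x ∨ᴮ y , x∨ᴮy∈F , λ g fg →
        OnB.≤′⇒≤ (IB.join-closed bx by) (F⊆B fg)
          (PB.join-least bx by (F⊆B fg) (proj₁ (Cp.above fg bx nx)) (proj₁ (Cp.above fg by ny))))
  ... | no ne = inj₁ (λ bx by → join-B-ordinary bx by (λ e → ne (_ , _ , e)))

theorem2p8 : (lem : ExcludedMiddle 0ℓ) {U : Set}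
    (SB : U → Set) (B : Ops U) (SC : U → Set) (C : Ops U) (F : U → Set)
    → IsIRL SB B → IsIRL SC C
    → (inter : ∀ u → (SB u × SC u → F u) × (F u → SB u × SC u))
    → AgreeOn F B C
    → IsCongFilter SC C F → StrictlyAbove SC C F
    → IsCongFilter SB B F → (cp : Compatible SB B F)
    → (jh : JoinHyp SB B F SC C)
    → IsGluing SB B SC C F (λ u → SB u ⊎ SC u)
        (Construction.⊕ lem SB B SC C F (λ {u} fu → proj₂ (proj₂ (inter u) fu)) cp jh)
theorem2p8 lem SB B SC C F irlB irlC inter agree filterC aboveC filterB cp jh = record
  { isIRL    = ⊕-isIRL
  ; universe = λ _ → (λ s → s) , (λ s → s)
  ; inter    = inter
  ; filter   = F-isCongFilter
  ; order-BC = B∖F<C∖F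
  ; order-CF = C∖F<F
  ; C-sub    = λ cx cy → meet-C cx cy , join-C cx cy , mul-C cx cy , ldiv-C cx cy , rdiv-C cx cy
  ; C-one    = refl
  ; B-sub    = B-agree
  ; B-one    = sym oneᴮ≡one
  ; B-join   = B-join
  }
  where open GluingConstruction lem SB B SC C F irlB irlC inter agree filterC aboveC filterB cp jh
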